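{- Let $n\ge1$, $k\ge2$. In the $(n,k)$-shift-game, $A^*$ is the only non-losing strategy for Alice: $A^*$ is non-losing, and every non-losing strategy $A$ for Alice satisfies $A=A^*$.
   Context: $[k]=\{0,\dots,k-1\}$; words written by concatenation. Prefer-max cycle: $(w_i)_{i=0}^{k^n-1}$ with $w_0=0^{n-1}(k-1)$ and, if $w_i=\sigma x$ ($\sigma\in[k]$, $x\in[k]^{n-1}$), $w_{i+1}=x\tau$ with $\tau$ the maximal letter such that $x\tau\notin\{w_0,\dots,w_i\}$; known (Martin) to be well defined and to enumerate $[k]^n$ exactly once. Indices are read modulo $k^n$ ($w_{ -1}=w_{k^n-1}$). Strategies: a strategy for Bob is $B\colon[k]^n\to\{0,1\}$ with $B(x(k-1))=0$ for all $x\in[k]^{n-1}$; a strategy for Alice is $A\colon[k]^n\to\{0,1\}$ with $A(x0)=0$ for all $x$. The $(n,k)$-shift-game: a play is $s_0,\dots,s_m$ with $s_0=0^n$ and, if $s_t=x\sigma$, then $s_{t+1}=(\sigma+1)x$ if $B(s_t)=1$; $s_{t+1}=0x$ if $B(s_t)=0$ and $A(s_t)=1$; $s_{t+1}=\sigma x$ otherwise. The play ends at the first $m>0$ with $s_m\in\{s_0,\dots,s_{m-1}\}$. Alice wins if $m<k^n$ and $s_m=0^n$; Bob wins if $s_m\ne0^n$; tie if $m=k^n$ and $s_m=0^n$. A strategy for a player is non-losing if, for every strategy of the opponent, the resulting play is not a win for the opponent. $B^*(w_i)=1$ iff $w_i=x\sigma$ and $w_{i-1}=(\sigma+1)x$ for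 some $x\in[k]^{n-1}$, $\sigma<k-1$; else $0$. $A^*(w_i)=1$ iff $w_i=x\sigma$ with $\sigma\ne0$ and ($w_{i-1}=0x$ or $B^*(w_i)=1$); else $0$. -}

module Defs where

open import Data.Nat using (ℕ; zero; suc; _+_; _^_; _∸_; _<_)
open import Data.Fin using (Fin; zero; suc; fromℕ)
import Data.Fin as Fin
open import Data.Vec using (Vec; []; _∷_; _∷ʳ_; replicate; init; last)
open import Data.Vec.Properties using (≡-dec)
open import Data.List using (List; []; _∷_; allFin; reverse; filter; upTo; head)
open import Data.Bool.ListAction using (any)
open import Data.List.Membership.DecPropositional using ()
import Data.List.Membership.DecPropositional as DecMem
open import Data.Maybe using (Maybe; just; nothing)
import Data.Maybe as Maybe
open import Data.Bool using (Bool; true; false; _∧_; _∨_; not; if_then_else_)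
open import Data.Product using (_×_; _,_; proj₁; proj₂; ∃)
open import Relation.Nullary using (¬_; ¬?)
open import Relation.Nullary.Decidable using (⌊_⌋)
open import Relation.Binary.PropositionalEquality using (_≡_; _≢_)

inc : ∀ {k} → Fin k → Maybe (Fin k)
inc {suc zero} zero = nothing
inc {suc (suc k)} zero = just (suc zero)
inc {suc (suc k)} (suc i) = Maybe.map suc (inc i)

-- The (n,k)-shift-game with n = suc m ≥ 1 and k = suc (suc j) ≥ 2.
module Game (m j : ℕ) where

  k : ℕ
  k = suc (suc j)

  n : ℕ
  n = suc m

  -- words of length n over the alphabet [k] = Fin k;
  -- a word σ x is σ ∷ x, a word x σ is x ∷ʳ σ
  Word : Set
  Word = Vec (Fin k) n

  _≟w_ : (u v : Word) → Relation.Nullary.Dec (u ≡ v)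
  _≟w_ = ≡-dec Fin._≟_

  open DecMem _≟w_ using (_∈?_)

  top : Fin k
  top = fromℕ (suc j)

  zeros : Word
  zeros = replicate n zero

  w₀ : Word
  w₀ = replicate m zero ∷ʳ top

  lettersDesc : List (Fin k)
  lettersDesc = reverse (allFin k)

  nextW : List Word → Word → Maybe Word
  nextW vis (σ ∷ x) =
    Maybe.map (x ∷ʳ_) (head (filter (λ τ → ¬? ((x ∷ʳ τ) ∈? vis)) lettersDesc))

  -- gen i = (w_i , [w_i, …, w_0])
  gen : ℕ → Word × List Word
  gen zero = w₀ , (w₀ ∷ [])
  gen (suc i) with gen i
  ... | c , vis with nextW vis c
  ...   | just v  = v , (v ∷ vis)
  ...   | nothing = c , vis

  K : ℕ
  K = k ^ n

  -- w_i (meaningful for i < K, where it is well defined by Martin's theorem)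
  w : ℕ → Word
  w i = proj₁ (gen i)

  -- index i-1 read modulo K (for 0 ≤ i < K)
  prev : ℕ → ℕ
  prev zero = K ∸ 1
  prev (suc i) = i

  BstarAt : ℕ → Bool
  BstarAt i with inc (last (w i))
  ... | just τ  = ⌊ w (prev i) ≟w (τ ∷ init (w i)) ⌋
  ... | nothing = false

  AstarAt : ℕ → Bool
  AstarAt i = not ⌊ last (w i) Fin.≟ zero ⌋
              ∧ (⌊ w (prev i) ≟w (zero ∷ init (w i)) ⌋ ∨ BstarAt i)

  -- as functions on words: v = w_i for the (unique) i < K
  Bstar : Word → Bool
  Bstar v = any (λ i → ⌊ w i ≟w v ⌋ ∧ BstarAt i) (upTo K)

  Astar : Word → Bool
  Astar v = any (λ i → ⌊ w i ≟w v ⌋ ∧ AstarAt i) (upTo K)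

  -- Strategies and the game   (1 = true, 0 = false)

  IsBobStrategy : (Word → Bool) → Set
  IsBobStrategy B = ∀ (x : Vec (Fin k) m) → B (x ∷ʳ top) ≡ false

  IsAliceStrategy : (Word → Bool) → Set
  IsAliceStrategy A = ∀ (x : Vec (Fin k) m) → A (x ∷ʳ zero) ≡ false

  -- one move from s = x σ
  -- (the case B(s)=1 with σ = k-1 cannot occur for a Bob strategy)
  move : (A B : Word → Bool) → Word → Word
  move A B s with B s | A s | inc (last s)
  ... | true  | _     | just τ  = τ ∷ init s
  ... | true  | _     | nothing = last s ∷ init s
  ... | false | true  | _       = zero ∷ init s
  ... | false | false | _       = last s ∷ init s

  play : (A B : Word → Bool) → ℕ → Word
  play A B zero = zeros
  play A B (suc t) = move A B (play A B t)

  Repeats : (A B : Word → Bool) → ℕ → Set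
  Repeats A B t = ∃ λ i → i < t × play A B i ≡ play A B t

  EndsAt : (A B : Word → Bool) → ℕ → Set
  EndsAt A B t = 0 < t × Repeats A B t
                 × (∀ t′ → 0 < t′ → t′ < t → ¬ Repeats A B t′)

  BobWins : (A B : Word → Bool) → Set
  BobWins A B = ∃ λ t → EndsAt A B t × play A B t ≢ zeros

  NonLosingAlice : (Word → Bool) → Set
  NonLosingAlice A = ∀ B → IsBobStrategy B → ¬ BobWins A B

module Submission where

-- The prefer-max sequence w₀, w₁, … never revisits a word before it gets stuck, and a word with a
-- larger last letter, or with a nonzero letter raised, always occurs earlier. Counting the
-- predecessors of the words x c shows that it gets stuck only after enumerating all K = kⁿ words,
-- ending with 0ⁿ (Martin). For a prefix x, the last letter next x c of the word following c x is
-- injective and increasing in the nonzero letters c, so next x c ∈ {c - 1, c}; this pins down how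
-- w_{i-1} = ρ x arises from w_i = x σ. With B*, A* walks the cycle backwards; against any Bob strategy
-- a move of A* either reaches 0ⁿ or strictly lowers the position in the cycle, so A* never loses.
-- If A differs from A* at w_i with i maximal, Bob plays B* except at w_i: the play runs backwards
-- from 0ⁿ = w_{K-1} to w_i, and A's move there leads to an already visited word other than 0ⁿ.

open import Defs
open import Data.Nat as ℕ using (ℕ; zero; suc; _+_; _∸_; _^_; z≤n; s≤s)
import Data.Nat.Properties as ℕP
open import Data.Nat.Induction using (<-rec)
open import Data.Fin as Fin using (Fin; zero; suc; toℕ; fromℕ; fromℕ<; punchOut; funToFin; finToFun)
import Data.Fin.Properties as FinP
open import Data.Vec as Vec using (Vec; []; _∷_; _∷ʳ_; replicate; init; last; tail)
import Data.Vec.Properties as VecP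
open import Data.List as List using (List; []; _∷_; allFin; reverse; filter; head; upTo)
import Data.List.Properties as ListP
open import Data.List.Membership.Propositional using (_∈_; _∉_; find; lose)
import Data.List.Membership.Propositional.Properties as ∈P
open import Data.List.Relation.Unary.Any using (here; there)
import Data.List.Relation.Unary.Any.Properties as AnyP
open import Data.List.Relation.Unary.All as All using ([]; _∷_)
open import Data.List.Relation.Unary.AllPairs as AllPairs using (AllPairs; []; _∷_)
import Data.List.Relation.Unary.AllPairs.Properties as AllPairsP
open import Data.Maybe using (just; nothing)
open import Data.Bool as Bool using (Bool; true; false; if_then_else_)
import Data.Bool.Properties as BoolP
open import Data.Bool.ListAction using (any)
open import Data.Product using (_×_; _,_; proj₁; proj₂; ∃)
open import Data.Sum using (_⊎_; inj₁; inj₂)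
open import Data.Empty using (⊥-elim)
open import Data.Unit using (⊤; tt)
open import Function using (id; _∘_; Equivalence)
open import Function.Definitions using (Injective)
open import Relation.Nullary using (¬_; Dec; yes; no; ¬?; _→-dec_)
open import Relation.Nullary.Decidable using (map′; ⌊_⌋; toWitness; fromWitness)
open import Relation.Unary using (Pred; Decidable)
open import Relation.Binary using (tri<; tri≈; tri>)
open import Relation.Binary.PropositionalEquality

init∷ʳlast : ∀ {a} {A : Set a} {l} (v : Vec A (suc l)) → v ≡ init v ∷ʳ last v
init∷ʳlast v = proj₂ (proj₂ (Vec.initLast v))

head∷tail : ∀ {a} {A : Set a} {l} (v : Vec A (suc l)) → v ≡ Vec.head v ∷ tail v
head∷tail (_ ∷ _) = refl

module _ {a ℓ} {A : Set a} {P : Pred A ℓ} (P? : Decidable P) where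

  head-filter≡nothing : ∀ {xs y} → head (filter P? xs) ≡ nothing → y ∈ xs → ¬ P y
  head-filter≡nothing {x ∷ xs} eq y∈ py with P? x
  head-filter≡nothing {x ∷ xs} () y∈ py | yes _
  head-filter≡nothing {x ∷ xs} eq (here refl) py | no ¬px = ¬px py
  head-filter≡nothing {x ∷ xs} eq (there y∈) py | no ¬px = head-filter≡nothing eq y∈ py

module _ {n ℓ} {P : Pred (Fin n) ℓ} (P? : Decidable P) where

  head-filter-descending : ∀ {xs τ} → AllPairs Fin._>_ xs → head (filter P? xs) ≡ just τ →
                           P τ × (∀ {τ′} → τ′ ∈ xs → P τ′ → τ′ Fin.≤ τ)
  head-filter-descending {x ∷ xs} (x>xs ∷ desc) eq with P? x
  ... | yes px with refl ← eq = px , λ where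
      (here refl) _ → ℕP.≤-refl
      (there τ′∈) _ → ℕP.<⇒≤ (All.lookup x>xs τ′∈)
  ... | no ¬px = proj₁ rec , λ where
      (here refl) pτ′ → ⊥-elim (¬px pτ′)
      (there τ′∈) pτ′ → proj₂ rec τ′∈ pτ′
    where rec = head-filter-descending desc eq

reverse-allFin-descending : ∀ n → AllPairs Fin._>_ (reverse (allFin n))
reverse-allFin-descending zero = []
reverse-allFin-descending (suc n) = subst (AllPairs Fin._>_) (sym unfold)
  (AllPairsP.++⁺ sucs-descending (All.[] ∷ []) (All.tabulate λ x∈ → sucs-positive x∈ ∷ []))
  where
  sucs = reverse (List.map suc (allFin n))
  unfold : reverse (allFin (suc n)) ≡ sucs List.++ (zero ∷ [])
  unfold = trans (ListP.unfold-reverse zero (List.tabulate suc))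
                 (cong (λ l → reverse l List.++ (zero ∷ [])) (sym (ListP.map-tabulate id suc)))
  sucs-descending : AllPairs Fin._>_ sucs
  sucs-descending = subst (AllPairs Fin._>_) (ListP.reverse-map suc (allFin n))
    (AllPairsP.map⁺ (AllPairs.map ℕ.s<s (reverse-allFin-descending n)))
  sucs-positive : ∀ {x} → x ∈ sucs → zero {n} Fin.< x
  sucs-positive x∈ with ∈P.∈-map⁻ suc {xs = allFin n} (AnyP.reverse⁻ {xs = List.map suc (allFin n)} x∈)
  ... | _ , _ , refl = s≤s z≤n

injective⇒hits : ∀ {N} {h : Fin (suc N) → Fin (suc N)} → Injective _≡_ _≡_ h →
                 ∀ c → ¬ (∀ a → h a ≢ c)
injective⇒hits {h = h} inj c avoids = ℕP.1+n≰n (FinP.injective⇒≤ punched-injective)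
  where
  punched-injective : Injective _≡_ _≡_ (λ a → punchOut (avoids a ∘ sym))
  punched-injective e = inj (FinP.punchOut-injective (avoids _ ∘ sym) (avoids _ ∘ sym) e)

funToFin-cong : ∀ {a b} {f g : Fin a → Fin b} → (∀ i → f i ≡ g i) → funToFin f ≡ funToFin g
funToFin-cong {zero} _ = refl
funToFin-cong {suc a} f≗g = cong₂ Fin.combine (f≗g zero) (funToFin-cong (f≗g ∘ suc))

module _ {a b : ℕ} where

  vecToFin : Vec (Fin b) a → Fin (b ^ a)
  vecToFin v = funToFin (Vec.lookup v)

  finToVec : Fin (b ^ a) → Vec (Fin b) a
  finToVec i = Vec.tabulate (finToFun i)

  finToVec-vecToFin : ∀ v → finToVec (vecToFin v) ≡ v
  finToVec-vecToFin v = trans (VecP.tabulate-cong (FinP.finToFun-funToFin (Vec.lookup v)))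
                              (VecP.tabulate∘lookup v)

  vecToFin-finToVec : ∀ i → vecToFin (finToVec i) ≡ i
  vecToFin-finToVec i = trans (funToFin-cong {a} {b} (VecP.lookup∘tabulate (finToFun i)))
                              (FinP.funToFin-finToFin {a} {b} i)

  vecToFin-injective : Injective _≡_ _≡_ vecToFin
  vecToFin-injective {v} {v′} e =
    trans (sym (finToVec-vecToFin v)) (trans (cong finToVec e) (finToVec-vecToFin v′))

  finToVec-injective : Injective _≡_ _≡_ finToVec
  finToVec-injective {i} {i′} e =
    trans (sym (vecToFin-finToVec i)) (trans (cong vecToFin e) (vecToFin-finToVec i′))

inc≡just⇒ : ∀ {n} {σ b : Fin n} → inc σ ≡ just b → toℕ b ≡ suc (toℕ σ)
inc≡just⇒ {suc zero} {zero} ()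
inc≡just⇒ {suc (suc n)} {zero} refl = refl
inc≡just⇒ {suc (suc n)} {suc σ} e with inc σ in inc≡
inc≡just⇒ {suc (suc n)} {suc σ} refl | just c = cong suc (inc≡just⇒ inc≡)

inc≡nothing⇒ : ∀ {n} {σ : Fin (suc n)} → inc σ ≡ nothing → σ ≡ fromℕ n
inc≡nothing⇒ {zero} {zero} refl = refl
inc≡nothing⇒ {suc n} {suc σ} e with inc σ in inc≡
inc≡nothing⇒ {suc n} {suc σ} refl | nothing = cong suc (inc≡nothing⇒ inc≡)

inc-fromℕ : ∀ n → inc (fromℕ n) ≡ nothing
inc-fromℕ zero = refl
inc-fromℕ (suc n) rewrite inc-fromℕ n = refl

inc-suc : ∀ {n} {σ ρ : Fin (suc n)} → toℕ ρ ≡ suc (toℕ σ) → inc σ ≡ just ρ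
inc-suc {n} {σ} {ρ} ρ≡1+σ with inc σ in inc≡
... | just b = cong just (FinP.toℕ-injective (trans (inc≡just⇒ inc≡) (sym ρ≡1+σ)))
... | nothing = ⊥-elim (ℕP.<-irrefl σ≡n (ℕP.≤-pred (subst (ℕ._< suc n) ρ≡1+σ (FinP.toℕ<n ρ))))
  where
  σ≡n : toℕ σ ≡ n
  σ≡n = trans (cong toℕ (inc≡nothing⇒ inc≡)) (FinP.toℕ-fromℕ n)

any-select : ∀ {a} {A : Set a} (p : A → Bool) {xs x} → x ∈ xs → (∀ {y} → y ∈ xs → Bool.T (p y) → y ≡ x) →
             any p xs ≡ p x
any-select p {xs} {x} x∈xs only-x with any p xs in any≡
... | true = let y , y∈xs , Tpy = find (AnyP.any⁻ p xs (subst Bool.T (sym any≡) tt))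
             in sym (Equivalence.to BoolP.T-≡ (subst (Bool.T ∘ p) (only-x y∈xs Tpy) Tpy))
... | false with p x in px≡
...   | false = refl
...   | true = ⊥-elim (subst Bool.T any≡ (AnyP.any⁺ p (lose x∈xs (subst Bool.T (sym px≡) tt))))

module _ {n : ℕ} where

  private
    Letter : Set
    Letter = Fin (suc n)

  data RaiseNonzero : ∀ {l} → Vec Letter l → Vec Letter l → Set where
    raise-here  : ∀ {l a b} {x : Vec Letter l} → 0 ℕ.< toℕ a → a Fin.< b → RaiseNonzero (a ∷ x) (b ∷ x)
    raise-there : ∀ {l c} {x y : Vec Letter l} → RaiseNonzero x y → RaiseNonzero (c ∷ x) (c ∷ y)

  data Raise {l} (v v′ : Vec Letter (suc l)) : Set where
    raise-last : ∀ x a b → a Fin.< b → v ≡ x ∷ʳ a → v′ ≡ x ∷ʳ b → Raise v v′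
    raise-init : ∀ x y a → RaiseNonzero x y → v ≡ x ∷ʳ a → v′ ≡ y ∷ʳ a → Raise v v′

  RaiseNonzero⇒≢replicate : ∀ {l} {x y : Vec Letter l} → RaiseNonzero x y → x ≢ replicate l zero
  RaiseNonzero⇒≢replicate (raise-here 0<a _) refl = ℕP.<-irrefl refl 0<a
  RaiseNonzero⇒≢replicate (raise-there r) e = RaiseNonzero⇒≢replicate r (VecP.∷-injectiveʳ e)

  private
    RaiseNonzero-∷ʳ : ∀ {l} (x : Vec Letter l) a y → RaiseNonzero (x ∷ʳ a) y →
      (∃ λ b → a Fin.< b × y ≡ x ∷ʳ b) ⊎ (∃ λ y₀ → RaiseNonzero x y₀ × y ≡ y₀ ∷ʳ a)
    RaiseNonzero-∷ʳ [] a (b ∷ []) (raise-here _ a<b) = inj₁ (b , a<b , refl)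
    RaiseNonzero-∷ʳ (c ∷ x) a (b ∷ _) (raise-here 0<c c<b) = inj₂ (b ∷ x , raise-here 0<c c<b , refl)
    RaiseNonzero-∷ʳ (c ∷ x) a (c ∷ y) (raise-there r) with RaiseNonzero-∷ʳ x a y r
    ... | inj₁ (b , a<b , refl) = inj₁ (b , a<b , refl)
    ... | inj₂ (y₀ , r′ , refl) = inj₂ (c ∷ y₀ , raise-there r′ , refl)

  RaiseNonzero⇒Raise-∷ : ∀ {l} γ {x y : Vec Letter l} → RaiseNonzero x y → Raise (γ ∷ x) (γ ∷ y)
  RaiseNonzero⇒Raise-∷ γ {[]} ()
  RaiseNonzero⇒Raise-∷ γ {x@(_ ∷ _)} {y} r
    with RaiseNonzero-∷ʳ (init x) (last x) y (subst (λ z → RaiseNonzero z y) (init∷ʳlast x) r)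
  ... | inj₁ (b , a<b , refl) = raise-last (γ ∷ init x) (last x) b a<b (cong (γ ∷_) (init∷ʳlast x)) refl
  ... | inj₂ (y₀ , r′ , refl) = raise-init (γ ∷ init x) (γ ∷ y₀) (last x) (raise-there r′) (cong (γ ∷_) (init∷ʳlast x)) refl

  Raise-head : ∀ {l a b} (x : Vec Letter l) → 0 ℕ.< toℕ a → a Fin.< b → Raise (a ∷ x) (b ∷ x)
  Raise-head [] _ a<b = raise-last [] _ _ a<b refl refl
  Raise-head {a = a} {b} x@(_ ∷ _) 0<a a<b = raise-init (a ∷ init x) (b ∷ init x) (last x) (raise-here 0<a a<b)
    (cong (a ∷_) (init∷ʳlast x)) (cong (b ∷_) (init∷ʳlast x))

module _ {n : ℕ} where

  shiftIn : ∀ {l} → Vec (Fin (suc n)) l → Vec (Fin (suc n)) l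
  shiftIn [] = []
  shiftIn (_ ∷ x) = x ∷ʳ zero

  shiftIn-∷ʳ : ∀ {l} (x : Vec (Fin (suc n)) l) → x ∷ʳ zero ≡ Vec.head (x ∷ʳ zero) ∷ shiftIn x
  shiftIn-∷ʳ [] = refl
  shiftIn-∷ʳ (_ ∷ _) = refl

  replicate-∷ʳ : ∀ l → replicate l zero ∷ʳ zero ≡ replicate {A = Fin (suc n)} (suc l) zero
  replicate-∷ʳ zero = refl
  replicate-∷ʳ (suc l) = cong (zero ∷_) (replicate-∷ʳ l)

  private
    ZerosFrom : ∀ {l} → ℕ → Vec (Fin (suc n)) l → Set
    ZerosFrom {l} zero x = x ≡ replicate l zero
    ZerosFrom (suc i) [] = ⊤
    ZerosFrom (suc i) (_ ∷ x) = ZerosFrom i x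

    ZerosFrom-[] : ∀ i → ZerosFrom i []
    ZerosFrom-[] zero = refl
    ZerosFrom-[] (suc i) = tt

    ZerosFrom-∷ʳ : ∀ {l} i (x : Vec (Fin (suc n)) l) → ZerosFrom i x → ZerosFrom i (x ∷ʳ zero)
    ZerosFrom-∷ʳ {l} zero x refl = replicate-∷ʳ l
    ZerosFrom-∷ʳ (suc i) [] _ = ZerosFrom-[] i
    ZerosFrom-∷ʳ (suc i) (_ ∷ x) z = ZerosFrom-∷ʳ i x z

    ZerosFrom-shiftIn : ∀ {l} i (x : Vec (Fin (suc n)) l) → ZerosFrom (suc i) x → ZerosFrom i (shiftIn x)
    ZerosFrom-shiftIn i [] _ = ZerosFrom-[] i
    ZerosFrom-shiftIn i (_ ∷ x) z = ZerosFrom-∷ʳ i x z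

    ZerosFrom-length : ∀ {l} (x : Vec (Fin (suc n)) l) → ZerosFrom l x
    ZerosFrom-length [] = refl
    ZerosFrom-length (_ ∷ x) = ZerosFrom-length x

    shiftIn-induction′ : ∀ {l ℓ} {P : Vec (Fin (suc n)) l → Set ℓ} → P (replicate l zero) →
                         (∀ x → P (shiftIn x) → P x) → ∀ i x → ZerosFrom i x → P x
    shiftIn-induction′ P0 step zero x refl = P0
    shiftIn-induction′ P0 step (suc i) x z = step x (shiftIn-induction′ P0 step i (shiftIn x) (ZerosFrom-shiftIn i x z))

  shiftIn-induction : ∀ {l ℓ} {P : Vec (Fin (suc n)) l → Set ℓ} → P (replicate l zero) →
                      (∀ x → P (shiftIn x) → P x) → ∀ x → P x
  shiftIn-induction {l} P0 step x = shiftIn-induction′ P0 step l x (ZerosFrom-length x)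

module IncreasingOnNonzero {N : ℕ} (g : Fin (suc N) → Fin (suc N))
  (increasing : ∀ {a b} → 0 ℕ.< toℕ a → a Fin.< b → g a Fin.< g b) where

  g[a]+d≤g[a+d] : ∀ d a b → toℕ b ≡ toℕ a + d → 0 ℕ.< toℕ a → toℕ (g a) + d ℕ.≤ toℕ (g b)
  g[a]+d≤g[a+d] zero a b b≡a+0 _ with FinP.toℕ-injective (trans b≡a+0 (ℕP.+-identityʳ _))
  ... | refl = ℕP.≤-reflexive (ℕP.+-identityʳ _)
  g[a]+d≤g[a+d] (suc d) a b b≡a+1+d 0<a = begin
    toℕ (g a) + suc d   ≡⟨ ℕP.+-suc _ d ⟩
    suc (toℕ (g a) + d) ≤⟨ s≤s (g[a]+d≤g[a+d] d a b′ toℕ-b′ 0<a) ⟩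
    suc (toℕ (g b′))    ≤⟨ increasing 0<b′ b′<b ⟩
    toℕ (g b)           ∎
    where
    open ℕP.≤-Reasoning
    b′-bound : toℕ a + d ℕ.< suc N
    b′-bound = ℕP.<-trans (ℕP.≤-reflexive (sym (trans b≡a+1+d (ℕP.+-suc _ d)))) (FinP.toℕ<n b)
    b′ = fromℕ< b′-bound
    toℕ-b′ : toℕ b′ ≡ toℕ a + d
    toℕ-b′ = FinP.toℕ-fromℕ< b′-bound
    0<b′ : 0 ℕ.< toℕ b′
    0<b′ = ℕP.<-≤-trans 0<a (subst (toℕ a ℕ.≤_) (sym toℕ-b′) (ℕP.m≤m+n _ d))
    b′<b : b′ Fin.< b
    b′<b = subst₂ ℕ._<_ (sym toℕ-b′) (sym (trans b≡a+1+d (ℕP.+-suc _ d))) ℕP.≤-refl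

  a≤1+g[a] : ∀ a → 0 ℕ.< toℕ a → toℕ a ℕ.≤ suc (toℕ (g a))
  a≤1+g[a] a 0<a with toℕ a in toℕ-a
  ... | suc a′ = s≤s (ℕP.≤-trans (ℕP.m≤n+m a′ _) (g[a]+d≤g[a+d] a′ one a a≡1+a′ 0<one))
    where
    1<N+1 : 1 ℕ.< suc N
    1<N+1 = ℕP.≤-<-trans (s≤s z≤n) (subst (ℕ._< suc N) toℕ-a (FinP.toℕ<n a))
    one = fromℕ< 1<N+1
    a≡1+a′ : toℕ a ≡ toℕ one + a′
    a≡1+a′ = trans toℕ-a (cong (_+ a′) (sym (FinP.toℕ-fromℕ< 1<N+1)))
    0<one : 0 ℕ.< toℕ one
    0<one = ℕP.≤-reflexive (sym (FinP.toℕ-fromℕ< 1<N+1))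

  private
    g[a]+[N∸a]<B : ∀ {B} → (∀ b → 0 ℕ.< toℕ b → toℕ (g b) ℕ.< B) →
                   ∀ a → 0 ℕ.< toℕ a → toℕ (g a) + (N ∸ toℕ a) ℕ.< B
    g[a]+[N∸a]<B bound a 0<a = ℕP.≤-<-trans (g[a]+d≤g[a+d] (N ∸ toℕ a) a (fromℕ N) N≡a+[N∸a] 0<a)
                                            (bound (fromℕ N) (ℕP.<-≤-trans 0<a a≤N′))
      where
      a≤N : toℕ a ℕ.≤ N
      a≤N = FinP.toℕ≤pred[n] a
      a≤N′ : toℕ a ℕ.≤ toℕ (fromℕ N)
      a≤N′ = subst (toℕ a ℕ.≤_) (sym (FinP.toℕ-fromℕ N)) a≤N
      N≡a+[N∸a] : toℕ (fromℕ N) ≡ toℕ a + (N ∸ toℕ a)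
      N≡a+[N∸a] = trans (FinP.toℕ-fromℕ N) (sym (ℕP.m+[n∸m]≡n a≤N))

    x+[N∸a]≤N⇒x≤a : ∀ x a → a ℕ.≤ N → x + (N ∸ a) ℕ.≤ N → x ℕ.≤ a
    x+[N∸a]≤N⇒x≤a x a a≤N le = subst (x ℕ.≤_) (ℕP.m∸[m∸n]≡n a≤N) (ℕP.m+n≤o⇒m≤o∸n x le)

  g[a]≤a : ∀ a → 0 ℕ.< toℕ a → toℕ (g a) ℕ.≤ toℕ a
  g[a]≤a a 0<a = x+[N∸a]≤N⇒x≤a _ _ (FinP.toℕ≤pred[n] a)
    (ℕP.≤-pred (g[a]+[N∸a]<B (λ b _ → FinP.toℕ<n (g b)) a 0<a))

  g≢top⇒g[a]<a : (∀ a → 0 ℕ.< toℕ a → g a ≢ fromℕ N) → ∀ a → 0 ℕ.< toℕ a → toℕ (g a) ℕ.< toℕ a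
  g≢top⇒g[a]<a g≢top a 0<a = x+[N∸a]≤N⇒x≤a _ _ (FinP.toℕ≤pred[n] a) (g[a]+[N∸a]<B g<N a 0<a)
    where
    g<N : ∀ b → 0 ℕ.< toℕ b → toℕ (g b) ℕ.< N
    g<N b 0<b = ℕP.≤∧≢⇒< (FinP.toℕ≤pred[n] (g b))
                  (λ e → g≢top b 0<b (FinP.toℕ-injective (trans e (sym (FinP.toℕ-fromℕ N)))))

  module _ (injective : Injective _≡_ _≡_ g) where

    -- otherwise c = 1 + g 0 ≤ b is squeezed to g c = g 0 between a ≤ 1 + g a and the gap from c to b
    g[1+σ]≡σ⇒σ<g[0] : ∀ σ b → toℕ b ≡ suc (toℕ σ) → g b ≡ σ → toℕ σ ℕ.< toℕ (g zero)
    g[1+σ]≡σ⇒σ<g[0] σ b b≡1+σ gb≡σ with toℕ σ ℕ.<? toℕ (g zero)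
    ... | yes σ<g0 = σ<g0
    ... | no σ≮g0 = ⊥-elim (ℕP.<-irrefl (cong toℕ (sym c≡0)) 0<c)
      where
      u = toℕ (g zero)
      u≤σ : u ℕ.≤ toℕ σ
      u≤σ = ℕP.≮⇒≥ σ≮g0
      c-bound : suc u ℕ.< suc N
      c-bound = ℕP.≤-<-trans (s≤s u≤σ) (subst (ℕ._< suc N) b≡1+σ (FinP.toℕ<n b))
      c = fromℕ< c-bound
      toℕ-c : toℕ c ≡ suc u
      toℕ-c = FinP.toℕ-fromℕ< c-bound
      0<c : 0 ℕ.< toℕ c
      0<c = subst (0 ℕ.<_) (sym toℕ-c) (s≤s z≤n)
      b≡c+[σ∸u] : toℕ b ≡ toℕ c + (toℕ σ ∸ u)
      b≡c+[σ∸u] = trans b≡1+σ (trans (cong suc (sym (ℕP.m+[n∸m]≡n u≤σ))) (cong (_+ (toℕ σ ∸ u)) (sym toℕ-c)))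
      gc≤u : toℕ (g c) ℕ.≤ u
      gc≤u = ℕP.+-cancelʳ-≤ (toℕ σ ∸ u) (toℕ (g c)) u (begin
        toℕ (g c) + (toℕ σ ∸ u) ≤⟨ g[a]+d≤g[a+d] (toℕ σ ∸ u) c b b≡c+[σ∸u] 0<c ⟩
        toℕ (g b)               ≡⟨ cong toℕ gb≡σ ⟩
        toℕ σ                   ≡⟨ ℕP.m+[n∸m]≡n u≤σ ⟨
        u + (toℕ σ ∸ u)         ∎)
        where open ℕP.≤-Reasoning
      u≤gc : u ℕ.≤ toℕ (g c)
      u≤gc = ℕP.≤-pred (subst (ℕ._≤ suc (toℕ (g c))) toℕ-c (a≤1+g[a] c 0<c))
      c≡0 : c ≡ zero
      c≡0 = injective (FinP.toℕ-injective (ℕP.≤-antisym gc≤u u≤gc))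

    -- otherwise c = g 0 ≥ σ is squeezed to g c = c between g a ≤ a and the gap from σ to c
    g[σ]≡σ⇒g[0]<σ : ∀ σ → 0 ℕ.< toℕ σ → g σ ≡ σ → toℕ (g zero) ℕ.< toℕ σ
    g[σ]≡σ⇒g[0]<σ σ 0<σ gσ≡σ with toℕ (g zero) ℕ.<? toℕ σ
    ... | yes g0<σ = g0<σ
    ... | no g0≮σ = ⊥-elim (ℕP.<-irrefl (cong toℕ (sym c≡0)) 0<c)
      where
      c = g zero
      σ≤c : toℕ σ ℕ.≤ toℕ c
      σ≤c = ℕP.≮⇒≥ g0≮σ
      0<c : 0 ℕ.< toℕ c
      0<c = ℕP.<-≤-trans 0<σ σ≤c
      c≤gc : toℕ c ℕ.≤ toℕ (g c)
      c≤gc = subst (ℕ._≤ toℕ (g c)) (trans (cong (λ z → toℕ z + (toℕ c ∸ toℕ σ)) gσ≡σ) (ℕP.m+[n∸m]≡n σ≤c))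
               (g[a]+d≤g[a+d] (toℕ c ∸ toℕ σ) σ c (sym (ℕP.m+[n∸m]≡n σ≤c)) 0<σ)
      c≡0 : c ≡ zero
      c≡0 = injective (FinP.toℕ-injective (ℕP.≤-antisym (g[a]≤a c 0<c) c≤gc))

module PreferMax (m j : ℕ) where

  open Game m j
  open import Data.List.Membership.DecPropositional _≟w_ using (_∈?_)

  Letter : Set
  Letter = Fin k

  Occurs≤ : ℕ → Word → Set
  Occurs≤ t v = ∃ λ i → i ℕ.≤ t × w i ≡ v

  Occurs< : ℕ → Word → Set
  Occurs< t v = ∃ λ i → i ℕ.< t × w i ≡ v

  Occurs≤⇒Occurs< : ∀ {t v} → Occurs≤ t v → Occurs< (suc t) v
  Occurs≤⇒Occurs< (i , i≤t , e) = i , s≤s i≤t , e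

  Occurs≤-suc : ∀ {t v} → Occurs≤ t v → Occurs≤ (suc t) v
  Occurs≤-suc (i , i≤t , e) = i , ℕP.m≤n⇒m≤1+n i≤t , e

  Occurs<-mono : ∀ {s t v} → s ℕ.≤ t → Occurs< s v → Occurs< t v
  Occurs<-mono s≤t (i , i<s , e) = i , ℕP.<-≤-trans i<s s≤t , e

  Occurs<⇒Occurs≤ : ∀ {s t v} → s ℕ.≤ t → Occurs< s v → Occurs≤ t v
  Occurs<⇒Occurs≤ s≤t (i , i<s , e) = i , ℕP.≤-trans (ℕP.<⇒≤ i<s) s≤t , e

  visited : ℕ → List Word
  visited t = proj₂ (gen t)

  private
    gen-step : ∀ t → (nextW (visited t) (w t) ≡ nothing × gen (suc t) ≡ gen t)
                   ⊎ (∃ λ v → nextW (visited t) (w t) ≡ just v × gen (suc t) ≡ (v , v ∷ visited t))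
    gen-step t with gen t
    ... | c , vis with nextW vis c
    ...   | just v = inj₂ (v , refl , refl)
    ...   | nothing = inj₁ (refl , refl)

    candidates : Vec Letter m → List Word → List Letter
    candidates x vis = filter (λ τ → ¬? ((x ∷ʳ τ) ∈? vis)) lettersDesc

    nextW≡just : ∀ vis c v → nextW vis c ≡ just v →
      ∃ λ τ → v ≡ tail c ∷ʳ τ × v ∉ vis × (∀ τ′ → τ Fin.< τ′ → (tail c ∷ʳ τ′) ∈ vis)
    nextW≡just vis (σ ∷ x) v eq with head (candidates x vis) in head≡
    nextW≡just vis (σ ∷ x) v refl | just τ = τ , refl , proj₁ maximal , larger-visited
      where
      maximal = head-filter-descending (λ τ → ¬? ((x ∷ʳ τ) ∈? vis)) (reverse-allFin-descending k) head≡
      larger-visited : ∀ τ′ → τ Fin.< τ′ → (x ∷ʳ τ′) ∈ vis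
      larger-visited τ′ τ<τ′ with (x ∷ʳ τ′) ∈? vis
      ... | yes τ′-visited = τ′-visited
      ... | no τ′-new = ⊥-elim (ℕP.<⇒≱ τ<τ′ (proj₂ maximal (AnyP.reverse⁺ (∈P.∈-allFin τ′)) τ′-new))

    nextW≡nothing : ∀ vis c → nextW vis c ≡ nothing → ∀ τ → (tail c ∷ʳ τ) ∈ vis
    nextW≡nothing vis (σ ∷ x) eq τ with head (candidates x vis) in head≡
    nextW≡nothing vis (σ ∷ x) () τ | just _
    nextW≡nothing vis (σ ∷ x) eq τ | nothing with (x ∷ʳ τ) ∈? vis
    ... | yes τ-visited = τ-visited
    ... | no τ-new = ⊥-elim (head-filter≡nothing (λ τ → ¬? ((x ∷ʳ τ) ∈? vis)) head≡
                               (AnyP.reverse⁺ (∈P.∈-allFin τ)) τ-new)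

    ∈visited⇒Occurs≤ : ∀ t {v} → v ∈ visited t → Occurs≤ t v
    ∈visited⇒Occurs≤ zero (here refl) = 0 , z≤n , refl
    ∈visited⇒Occurs≤ (suc t) v∈ with gen-step t
    ... | inj₁ (_ , gen≡) rewrite gen≡ = Occurs≤-suc (∈visited⇒Occurs≤ t v∈)
    ... | inj₂ (u , _ , gen≡) rewrite gen≡ with v∈
    ...   | here refl = suc t , ℕP.≤-refl , cong proj₁ gen≡
    ...   | there v∈′ = Occurs≤-suc (∈visited⇒Occurs≤ t v∈′)

    Occurs≤⇒∈visited : ∀ t {v} → Occurs≤ t v → v ∈ visited t
    Occurs≤⇒∈visited zero (zero , _ , refl) = here refl
    Occurs≤⇒∈visited (suc t) {v} (i , i≤ , e) with gen-step t | ℕP.m≤n⇒m<n∨m≡n i≤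
    ... | inj₁ (_ , gen≡) | inj₁ i<1+t =
      subst (λ p → v ∈ proj₂ p) (sym gen≡) (Occurs≤⇒∈visited t (i , ℕP.≤-pred i<1+t , e))
    ... | inj₁ (_ , gen≡) | inj₂ refl =
      subst (λ p → v ∈ proj₂ p) (sym gen≡) (Occurs≤⇒∈visited t (t , ℕP.≤-refl , trans (sym (cong proj₁ gen≡)) e))
    ... | inj₂ (u , _ , gen≡) | inj₁ i<1+t =
      subst (λ p → v ∈ proj₂ p) (sym gen≡) (there (Occurs≤⇒∈visited t (i , ℕP.≤-pred i<1+t , e)))
    ... | inj₂ (u , _ , gen≡) | inj₂ refl =
      subst (λ p → v ∈ proj₂ p) (sym gen≡) (here (trans (sym e) (cong proj₁ gen≡)))

  Stuck : ℕ → Set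
  Stuck t = ∀ τ → Occurs≤ t (tail (w t) ∷ʳ τ)

  Advances : ℕ → Set
  Advances t = ∃ λ τ → w (suc t) ≡ tail (w t) ∷ʳ τ × ¬ Occurs≤ t (w (suc t))
                     × (∀ τ′ → τ Fin.< τ′ → Occurs≤ t (tail (w t) ∷ʳ τ′))

  stuck⊎advances : ∀ t → (Stuck t × w (suc t) ≡ w t) ⊎ Advances t
  stuck⊎advances t with gen-step t
  ... | inj₁ (next≡ , gen≡) =
    inj₁ ((λ τ → ∈visited⇒Occurs≤ t (nextW≡nothing (visited t) (w t) next≡ τ)) , cong proj₁ gen≡)
  ... | inj₂ (v , next≡ , gen≡) with nextW≡just (visited t) (w t) v next≡
  ...   | τ , v≡ , v-new , larger = inj₂ (τ , trans (cong proj₁ gen≡) v≡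
          , (λ occ → v-new (Occurs≤⇒∈visited t (subst (Occurs≤ t) (cong proj₁ gen≡) occ)))
          , λ τ′ τ<τ′ → ∈visited⇒Occurs≤ t (larger τ′ τ<τ′))

  Stuck⇒w-const : ∀ {t} → Stuck t → w (suc t) ≡ w t
  Stuck⇒w-const {t} stuck with stuck⊎advances t
  ... | inj₁ (_ , w-const) = w-const
  ... | inj₂ (τ , w≡ , new , _) = ⊥-elim (new (subst (Occurs≤ t) (sym w≡) (stuck τ)))

  Stuck-suc : ∀ {t} → Stuck t → Stuck (suc t)
  Stuck-suc stuck τ = subst (λ z → Occurs≤ _ (tail z ∷ʳ τ)) (sym (Stuck⇒w-const stuck)) (Occurs≤-suc (stuck τ))

  Stuck-mono : ∀ {s t} → s ℕ.≤ t → Stuck s → Stuck t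
  Stuck-mono s≤t stuck with ℕP.m≤n⇒m<n∨m≡n s≤t
  ... | inj₂ refl = stuck
  ... | inj₁ (s≤s s≤t′) = Stuck-suc (Stuck-mono s≤t′ stuck)

  Unstuck : ℕ → Set
  Unstuck t = ∀ s → s ℕ.< t → ¬ Stuck s

  Unstuck-mono : ∀ {s t} → s ℕ.≤ t → Unstuck t → Unstuck s
  Unstuck-mono s≤t unstuck s′ s′<s = unstuck s′ (ℕP.<-≤-trans s′<s s≤t)

  Unstuck⇒Advances : ∀ {s} → Unstuck (suc s) → Advances s
  Unstuck⇒Advances {s} unstuck with stuck⊎advances s
  ... | inj₁ (stuck , _) = ⊥-elim (unstuck s ℕP.≤-refl stuck)
  ... | inj₂ advances = advances

  Advances⇒Unstuck : ∀ {s} → Advances s → Unstuck (suc s)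
  Advances⇒Unstuck {s} (τ , w≡ , new , _) s′ s′<1+s stuck =
    new (subst (Occurs≤ s) (sym w≡) (Stuck-mono (ℕP.≤-pred s′<1+s) stuck τ))

  private
    Unstuck⇒w-new : ∀ {t i i′} → Unstuck t → i ℕ.< i′ → i′ ℕ.≤ t → w i ≢ w i′
    Unstuck⇒w-new {i′ = suc p} unstuck i<i′ i′≤t e =
      proj₁ (proj₂ (proj₂ (Unstuck⇒Advances (Unstuck-mono i′≤t unstuck)))) (_ , ℕP.≤-pred i<i′ , e)

  w-injective : ∀ {t i i′} → Unstuck t → i ℕ.≤ t → i′ ℕ.≤ t → w i ≡ w i′ → i ≡ i′
  w-injective {t} {i} {i′} unstuck i≤t i′≤t e with ℕP.<-cmp i i′
  ... | tri< i<i′ _ _ = ⊥-elim (Unstuck⇒w-new unstuck i<i′ i′≤t e)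
  ... | tri≈ _ i≡i′ _ = i≡i′
  ... | tri> _ _ i′<i = ⊥-elim (Unstuck⇒w-new unstuck i′<i i≤t (sym e))

  top-maximal : ∀ (τ : Letter) → ¬ (top Fin.< τ)
  top-maximal τ top<τ = ℕP.<⇒≱ top<τ (subst (toℕ τ ℕ.≤_) (sym (FinP.toℕ-fromℕ (suc j))) (FinP.toℕ≤pred[n] τ))

  w-zero-init : ∀ {x : Vec Letter m} {c} → w 0 ≡ x ∷ʳ c → x ≡ replicate m zero
  w-zero-init {x} e = sym (VecP.∷ʳ-injectiveˡ (replicate m zero) x e)

  Advances⇒init : ∀ {s} → Advances s → init (w (suc s)) ≡ tail (w s)
  Advances⇒init {s} (τ , w≡ , _) = trans (cong init w≡) (VecP.init-∷ʳ τ (tail (w s)))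

  w-suc-shape : ∀ {t r} → Unstuck t → suc r ℕ.≤ t → w (suc r) ≡ tail (w r) ∷ʳ last (w (suc r))
  w-suc-shape {r = r} unstuck 1+r≤t = trans (init∷ʳlast (w (suc r)))
    (cong (_∷ʳ last (w (suc r))) (Advances⇒init (Unstuck⇒Advances (Unstuck-mono 1+r≤t unstuck))))

  w-pred-shape : ∀ {t p X c} → Unstuck t → suc p ℕ.≤ t → w (suc p) ≡ X ∷ʳ c → w p ≡ Vec.head (w p) ∷ X
  w-pred-shape {p = p} {X} {c} unstuck 1+p≤t w≡ = begin
    w p                                  ≡⟨ head∷tail (w p) ⟩
    Vec.head (w p) ∷ tail (w p)          ≡⟨ cong (Vec.head (w p) ∷_) (Advances⇒init advances) ⟨
    Vec.head (w p) ∷ init (w (suc p))    ≡⟨ cong (λ z → Vec.head (w p) ∷ init z) w≡ ⟩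
    Vec.head (w p) ∷ init (X ∷ʳ c)       ≡⟨ cong (Vec.head (w p) ∷_) (VecP.init-∷ʳ c X) ⟩
    Vec.head (w p) ∷ X                   ∎
    where
    open ≡-Reasoning
    advances = Unstuck⇒Advances (Unstuck-mono 1+p≤t unstuck)

  larger-last-occurs-earlier : ∀ t τ′ → last (w t) Fin.< τ′ → Occurs< t (init (w t) ∷ʳ τ′)
  larger-last-occurs-earlier zero τ′ σ<τ′ =
    ⊥-elim (top-maximal τ′ (subst (Fin._< τ′) (VecP.last-∷ʳ top (replicate m zero)) σ<τ′))
  larger-last-occurs-earlier (suc s) τ′ σ<τ′ with stuck⊎advances s
  ... | inj₁ (_ , w-const) = Occurs<-mono (ℕP.n≤1+n s)
    (subst (λ z → Occurs< s (init z ∷ʳ τ′)) (sym w-const)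
      (larger-last-occurs-earlier s τ′ (subst (λ z → last z Fin.< τ′) w-const σ<τ′)))
  ... | inj₂ advances@(τ , w≡ , _ , larger) =
    subst (λ z → Occurs< (suc s) (z ∷ʳ τ′)) (sym (Advances⇒init advances))
      (Occurs≤⇒Occurs< (larger τ′ (subst (Fin._< τ′) last≡τ σ<τ′)))
    where
    last≡τ : last (w (suc s)) ≡ τ
    last≡τ = trans (cong last w≡) (VecP.last-∷ʳ τ (tail (w s)))

  RaisedOccurEarlier : ℕ → Set
  RaisedOccurEarlier t = ∀ v′ → Raise (w t) v′ → Occurs< t v′

  private
    module RaiseInit (s : ℕ) (ih : ∀ p → p ℕ.< suc s → RaisedOccurEarlier p) (advances : Advances s)
                     (y : Vec Letter m) (raise : RaiseNonzero (tail (w s)) y) where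
      X = tail (w s)
      τ = proj₁ advances

      unstuck : Unstuck (suc s)
      unstuck = Advances⇒Unstuck advances

      X-occurs : ∀ c → τ Fin.≤ c → Occurs≤ (suc s) (X ∷ʳ c)
      X-occurs c τ≤c with ℕP.m≤n⇒m<n∨m≡n τ≤c
      ... | inj₁ τ<c = Occurs≤-suc (proj₂ (proj₂ (proj₂ advances)) c τ<c)
      ... | inj₂ τ≡c = suc s , ℕP.≤-refl , trans (proj₁ (proj₂ advances)) (cong (X ∷ʳ_) (FinP.toℕ-injective τ≡c))

      record Witness (c : Letter) : Set where
        field
          p r : ℕ
          p≤s : p ℕ.≤ s
          r<p : r ℕ.< p
          w-suc-p : w (suc p) ≡ X ∷ʳ c
          w-r : w r ≡ Vec.head (w p) ∷ y
      open Witness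

      w-p : ∀ {c} (d : Witness c) → w (p d) ≡ Vec.head (w (p d)) ∷ X
      w-p d = w-pred-shape unstuck (s≤s (p≤s d)) (w-suc-p d)

      witness : ∀ c → τ Fin.≤ c → Witness c
      witness c τ≤c with X-occurs c τ≤c
      ... | zero , _ , w₀≡ = ⊥-elim (RaiseNonzero⇒≢replicate raise (w-zero-init w₀≡))
      ... | suc p , 1+p≤1+s , w≡ with ih p 1+p≤1+s (Vec.head (w p) ∷ y)
             (subst (λ z → Raise z (Vec.head (w p) ∷ y)) (sym (w-pred-shape unstuck 1+p≤1+s w≡))
               (RaiseNonzero⇒Raise-∷ (Vec.head (w p)) raise))
      ...   | r , r<p , w-r = record { p = p ; r = r ; p≤s = ℕP.≤-pred 1+p≤1+s ; r<p = r<p ; w-suc-p = w≡ ; w-r = w-r }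

      1+r≤1+s : ∀ {c} (d : Witness c) → suc (r d) ℕ.≤ suc s
      1+r≤1+s d = ℕP.m≤n⇒m≤1+n (ℕP.≤-trans (r<p d) (p≤s d))

      follower : ∀ {c} → Witness c → Letter
      follower d = last (w (suc (r d)))

      w-suc-r : ∀ {c} (d : Witness c) → w (suc (r d)) ≡ y ∷ʳ follower d
      w-suc-r d = trans (w-suc-shape unstuck (1+r≤1+s d)) (cong (_∷ʳ follower d) (cong tail (w-r d)))

      follower-injective : ∀ {c c′} (d : Witness c) (d′ : Witness c′) → follower d ≡ follower d′ → c ≡ c′
      follower-injective d d′ e = VecP.∷ʳ-injectiveʳ X X
        (trans (sym (w-suc-p d)) (trans (cong (λ z → w (suc z)) p≡p′) (w-suc-p d′)))
        where
        r≡r′ : r d ≡ r d′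
        r≡r′ = ℕP.suc-injective (w-injective unstuck (1+r≤1+s d) (1+r≤1+s d′)
                 (trans (w-suc-r d) (trans (cong (y ∷ʳ_) e) (sym (w-suc-r d′)))))
        heads≡ : Vec.head (w (p d)) ≡ Vec.head (w (p d′))
        heads≡ = VecP.∷-injectiveˡ (trans (sym (w-r d)) (trans (cong w r≡r′) (w-r d′)))
        p≡p′ : p d ≡ p d′
        p≡p′ = w-injective unstuck (ℕP.m≤n⇒m≤1+n (p≤s d)) (ℕP.m≤n⇒m≤1+n (p≤s d′))
                 (trans (w-p d) (trans (cong (_∷ X) heads≡) (sym (w-p d′))))

      -- the followers of the k - τ letters c ≥ τ are distinct, so they cannot all exceed τ
      g : Letter → Letter
      g c with τ Fin.≤? c
      ... | yes τ≤c = follower (witness c τ≤c)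
      ... | no _ = c

      FollowerAbove : Letter → Set
      FollowerAbove c = τ Fin.≤ c → τ Fin.< g c

      some-follower≤τ : ∃ λ c → ∃ λ (d : Witness c) → toℕ (follower d) ℕ.≤ toℕ τ
      some-follower≤τ with FinP.¬∀⟶∃¬ k FollowerAbove (λ c → (τ Fin.≤? c) →-dec (τ Fin.<? g c)) all-above
        where
        all-above : ¬ (∀ c → FollowerAbove c)
        all-above above = injective⇒hits g-injective τ g≢τ
          where
          g≢τ : ∀ c → g c ≢ τ
          g≢τ c with τ Fin.≤? c | above c
          ... | yes τ≤c | τ<gc = λ e → ℕP.<-irrefl (cong toℕ (sym e)) (τ<gc τ≤c)
          ... | no τ≰c | _ = λ e → τ≰c (ℕP.≤-reflexive (cong toℕ (sym e)))
          g-injective : Injective _≡_ _≡_ g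
          g-injective {a} {b} e with τ Fin.≤? a | τ Fin.≤? b | above a | above b
          ... | yes τ≤a | yes τ≤b | _ | _ = follower-injective (witness a τ≤a) (witness b τ≤b) e
          ... | no _ | no _ | _ | _ = e
          ... | yes τ≤a | no τ≰b | τ<ga | _ = ⊥-elim (τ≰b (ℕP.<⇒≤ (subst (τ Fin.<_) e (τ<ga τ≤a))))
          ... | no τ≰a | yes τ≤b | _ | τ<gb = ⊥-elim (τ≰a (ℕP.<⇒≤ (subst (τ Fin.<_) (sym e) (τ<gb τ≤b))))
      ... | c , ¬above with τ Fin.≤? c
      ...   | yes τ≤c = c , witness c τ≤c , ℕP.≮⇒≥ (λ τ<gc → ¬above (λ _ → τ<gc))
      ...   | no τ≰c = ⊥-elim (¬above (λ τ≤c → ⊥-elim (τ≰c τ≤c)))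

      yτ-occurs : Occurs< (suc s) (y ∷ʳ τ)
      yτ-occurs with some-follower≤τ
      ... | c , d , f≤τ with ℕP.m≤n⇒m<n∨m≡n f≤τ
      ...   | inj₂ f≡τ = suc (r d) , s≤s (ℕP.≤-trans (r<p d) (p≤s d)) , trans (w-suc-r d) (cong (y ∷ʳ_) (FinP.toℕ-injective f≡τ))
      ...   | inj₁ f<τ = Occurs<-mono (1+r≤1+s d)
                (subst (λ z → Occurs< (suc (r d)) (z ∷ʳ τ)) (trans (cong init (w-suc-r d)) (VecP.init-∷ʳ _ y))
                  (larger-last-occurs-earlier (suc (r d)) τ f<τ))

  raised-occurs-earlier : ∀ t → RaisedOccurEarlier t
  raised-occurs-earlier = <-rec RaisedOccurEarlier (λ t ih → step t (λ p → ih {p}))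
    where
    step : ∀ t → (∀ p → p ℕ.< t → RaisedOccurEarlier p) → RaisedOccurEarlier t
    step zero ih v′ (raise-last x a b a<b w≡ _) =
      ⊥-elim (top-maximal b (subst (Fin._< b) (sym (VecP.∷ʳ-injectiveʳ (replicate m zero) x w≡)) a<b))
    step zero ih v′ (raise-init x y a raise w≡ _) = ⊥-elim (RaiseNonzero⇒≢replicate raise (w-zero-init w≡))
    step (suc s) ih v′ raise with stuck⊎advances s
    ... | inj₁ (_ , w-const) = Occurs<-mono (ℕP.n≤1+n s) (ih s ℕP.≤-refl v′ (subst (λ z → Raise z v′) w-const raise))
    ... | inj₂ advances@(τ , w≡ , _ , larger) with raise
    ...   | raise-last x a b a<b w≡′ v′≡ with VecP.∷ʳ-injective x (tail (w s)) (trans (sym w≡′) w≡)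
    ...     | refl , refl = subst (Occurs< (suc s)) (sym v′≡) (Occurs≤⇒Occurs< (larger b a<b))
    step (suc s) ih v′ raise | inj₂ advances@(τ , w≡ , _ , _) | raise-init x y a r w≡′ v′≡
      with VecP.∷ʳ-injective x (tail (w s)) (trans (sym w≡′) w≡)
    ... | refl , refl = subst (Occurs< (suc s)) (sym v′≡) (RaiseInit.yτ-occurs s ih advances y r)

  x∷ʳ0-occurs⇒x∷ʳc-occurs : ∀ {t} {x : Vec Letter m} → Occurs≤ t (x ∷ʳ zero) → ∀ c → Occurs≤ t (x ∷ʳ c)
  x∷ʳ0-occurs⇒x∷ʳc-occurs x0-occurs zero = x0-occurs
  x∷ʳ0-occurs⇒x∷ʳc-occurs {x = x} (i , i≤t , w≡) (suc c) =
    Occurs<⇒Occurs≤ i≤t (subst (λ z → Occurs< i (z ∷ʳ suc c)) init≡x (larger-last-occurs-earlier i (suc c) 0<1+c))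
    where
    init≡x : init (w i) ≡ x
    init≡x = trans (cong init w≡) (VecP.init-∷ʳ zero x)
    0<1+c : last (w i) Fin.< suc c
    0<1+c = subst (Fin._< suc c) (sym (trans (cong last w≡) (VecP.last-∷ʳ zero x))) (s≤s z≤n)

  Occurs≤? : ∀ t v → Dec (Occurs≤ t v)
  Occurs≤? t v = map′ (∈visited⇒Occurs≤ t) (Occurs≤⇒∈visited t) (v ∈? visited t)

  Unstuck⇒1+t≤K : ∀ {t} → Unstuck t → suc t ℕ.≤ K
  Unstuck⇒1+t≤K unstuck = FinP.injective⇒≤ λ {i} {i′} e → FinP.toℕ-injective
    (w-injective unstuck (ℕP.≤-pred (FinP.toℕ<n i)) (ℕP.≤-pred (FinP.toℕ<n i′)) (vecToFin-injective e))

  first-stuck : ∀ t → Unstuck t ⊎ ∃ λ T → T ℕ.< t × Unstuck T × Stuck T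
  first-stuck zero = inj₁ (λ _ ())
  first-stuck (suc t) with first-stuck t
  ... | inj₂ (T , T<t , unstuck , stuck) = inj₂ (T , ℕP.m≤n⇒m≤1+n T<t , unstuck , stuck)
  ... | inj₁ unstuck with stuck⊎advances t
  ...   | inj₁ (stuck , _) = inj₂ (t , ℕP.≤-refl , unstuck , stuck)
  ...   | inj₂ advances = inj₁ (Advances⇒Unstuck advances)

  0s : Vec Letter m
  0s = replicate m zero

  X∷ʳc≢w₀ : ∀ {X : Vec Letter m} {c} → X ≢ 0s → X ∷ʳ c ≢ w 0
  X∷ʳc≢w₀ X≢0s e = X≢0s (w-zero-init (sym e))

  record Predecessor (T : ℕ) (X : Vec Letter m) (c : Letter) : Set where
    field
      p : ℕ
      p<T : p ℕ.< T
      w-suc-p : w (suc p) ≡ X ∷ʳ c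

    letter : Letter
    letter = Vec.head (w p)

  module _ {T} (unstuck : Unstuck T) where

    predecessor : ∀ {X c} → Occurs≤ T (X ∷ʳ c) → X ∷ʳ c ≢ w 0 → Predecessor T X c
    predecessor (zero , _ , w₀≡) ≢w₀ = ⊥-elim (≢w₀ (sym w₀≡))
    predecessor (suc p , 1+p≤T , w≡) _ = record { p = p ; p<T = 1+p≤T ; w-suc-p = w≡ }

    predecessor-shape : ∀ {X c} (d : Predecessor T X c) → w (Predecessor.p d) ≡ Predecessor.letter d ∷ X
    predecessor-shape d = w-pred-shape unstuck (Predecessor.p<T d) (Predecessor.w-suc-p d)

    predecessor-occurs : ∀ {X c} (d : Predecessor T X c) → Occurs≤ T (Predecessor.letter d ∷ X)
    predecessor-occurs d = Predecessor.p d , ℕP.<⇒≤ (Predecessor.p<T d) , predecessor-shape d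

    predecessor-injective : ∀ {X c c′} (d : Predecessor T X c) (d′ : Predecessor T X c′) →
                            Predecessor.letter d ≡ Predecessor.letter d′ → c ≡ c′
    predecessor-injective {X} d d′ e = VecP.∷ʳ-injectiveʳ X X
      (trans (sym (Predecessor.w-suc-p d)) (trans (cong (λ z → w (suc z)) p≡p′) (Predecessor.w-suc-p d′)))
      where
      p≡p′ : Predecessor.p d ≡ Predecessor.p d′
      p≡p′ = w-injective unstuck (ℕP.<⇒≤ (Predecessor.p<T d)) (ℕP.<⇒≤ (Predecessor.p<T d′))
               (trans (predecessor-shape d) (trans (cong (_∷ X) e) (sym (predecessor-shape d′))))

    -- the k distinct predecessor letters of X exhaust the alphabet
    predecessors-occur : ∀ {X} → X ≢ 0s → (∀ c → Occurs≤ T (X ∷ʳ c)) → ∀ ρ → Occurs≤ T (ρ ∷ X)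
    predecessors-occur {X} X≢0s X-occurs ρ with Occurs≤? T (ρ ∷ X)
    ... | yes ρX-occurs = ρX-occurs
    ... | no ρX-new = ⊥-elim (injective⇒hits (predecessor-injective (pred _) (pred _)) ρ
                               (λ c e → ρX-new (subst (λ z → Occurs≤ T (z ∷ X)) e (predecessor-occurs (pred c)))))
      where
      pred : ∀ c → Predecessor T X c
      pred c = predecessor (X-occurs c) (X∷ʳc≢w₀ X≢0s)

  module _ {T} (unstuck : Unstuck T) (stuck : Stuck T) where

    private
      σT : Letter
      σT = Vec.head (w T)

      predecessor≢σT : ∀ {c} (d : Predecessor T (tail (w T)) c) → Predecessor.letter d ≢ σT
      predecessor≢σT d e = ℕP.<-irrefl p≡T (Predecessor.p<T d)
        where
        p≡T : Predecessor.p d ≡ T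
        p≡T = w-injective unstuck (ℕP.<⇒≤ (Predecessor.p<T d)) ℕP.≤-refl
                (trans (predecessor-shape unstuck d) (trans (cong (_∷ tail (w T)) e) (sym (head∷tail (w T)))))

    -- otherwise the k predecessor letters of the stuck suffix would all differ from σT
    stuck-tail≡0s : tail (w T) ≡ 0s
    stuck-tail≡0s with VecP.≡-dec FinP._≟_ (tail (w T)) 0s
    ... | yes tail≡0s = tail≡0s
    ... | no tail≢0s = ⊥-elim (injective⇒hits (predecessor-injective unstuck (pred _) (pred _)) σT
                                 (λ c → predecessor≢σT (pred c)))
      where
      pred : ∀ c → Predecessor T (tail (w T)) c
      pred c = predecessor unstuck (stuck c) (X∷ʳc≢w₀ tail≢0s)

    private
      0s-occurs : ∀ c → Occurs≤ T (0s ∷ʳ c)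
      0s-occurs c = subst (λ z → Occurs≤ T (z ∷ʳ c)) stuck-tail≡0s (stuck c)

    -- as above, with w T = σT 0ᵐ standing in for the missing predecessor of w 0 = 0ᵐ (k-1)
    ρ∷0s-occurs : ∀ ρ → Occurs≤ T (ρ ∷ 0s)
    ρ∷0s-occurs ρ with Occurs≤? T (ρ ∷ 0s)
    ... | yes ρ0-occurs = ρ0-occurs
    ... | no ρ0-new = ⊥-elim (injective⇒hits h-injective ρ h≢ρ)
      where
      pred : ∀ c → c ≢ top → Predecessor T (tail (w T)) c
      pred c c≢top = subst (λ z → Predecessor T z c) (sym stuck-tail≡0s)
        (predecessor unstuck (0s-occurs c) (λ e → c≢top (VecP.∷ʳ-injectiveʳ 0s 0s e)))
      h : Letter → Letter
      h c with c FinP.≟ top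
      ... | yes _ = σT
      ... | no c≢top = Predecessor.letter (pred c c≢top)
      h-injective : Injective _≡_ _≡_ h
      h-injective {a} {b} e with a FinP.≟ top | b FinP.≟ top
      ... | yes a≡top | yes b≡top = trans a≡top (sym b≡top)
      ... | no a≢top | no b≢top = predecessor-injective unstuck (pred a a≢top) (pred b b≢top) e
      ... | yes _ | no b≢top = ⊥-elim (predecessor≢σT (pred b b≢top) (sym e))
      ... | no a≢top | yes _ = ⊥-elim (predecessor≢σT (pred a a≢top) e)
      h≢ρ : ∀ c → h c ≢ ρ
      h≢ρ c e with c FinP.≟ top
      ... | yes _ = ρ0-new (T , ℕP.≤-refl , trans (head∷tail (w T)) (cong₂ _∷_ e stuck-tail≡0s))
      ... | no c≢top = ρ0-new (subst (λ z → Occurs≤ T (z ∷ 0s)) e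
                         (subst (λ z → Occurs≤ T (Predecessor.letter (pred c c≢top) ∷ z)) stuck-tail≡0s
                           (predecessor-occurs unstuck (pred c c≢top))))

    private
      x∷ʳ0-occurs : ∀ x → Occurs≤ T (x ∷ʳ zero)
      x∷ʳ0-occurs = shiftIn-induction (subst (Occurs≤ T) (sym (replicate-∷ʳ m)) (ρ∷0s-occurs zero)) step
        where
        step : ∀ x → Occurs≤ T (shiftIn x ∷ʳ zero) → Occurs≤ T (x ∷ʳ zero)
        step x shifted-occurs with VecP.≡-dec FinP._≟_ (shiftIn x) 0s
        ... | yes shifted≡0s = subst (Occurs≤ T) (sym (trans (shiftIn-∷ʳ x) (cong (Vec.head (x ∷ʳ zero) ∷_) shifted≡0s))) (ρ∷0s-occurs _)
        ... | no shifted≢0s = subst (Occurs≤ T) (sym (shiftIn-∷ʳ x))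
                (predecessors-occur unstuck shifted≢0s (x∷ʳ0-occurs⇒x∷ʳc-occurs shifted-occurs) _)

    all-occur : ∀ v → Occurs≤ T v
    all-occur v = subst (Occurs≤ T) (sym (init∷ʳlast v)) (x∷ʳ0-occurs⇒x∷ʳc-occurs (x∷ʳ0-occurs (init v)) (last v))

  record Enumeration : Set where
    field
      T : ℕ
      1+T≡K : suc T ≡ K
      unstuck : Unstuck T
      occurs : ∀ v → Occurs≤ T v

  enumeration : Enumeration
  enumeration with first-stuck K
  ... | inj₁ unstuck = ⊥-elim (ℕP.1+n≰n (Unstuck⇒1+t≤K unstuck))
  ... | inj₂ (T , T<K , unstuck , stuck) = record
    { T = T ; 1+T≡K = ℕP.≤-antisym T<K K≤1+T ; unstuck = unstuck ; occurs = all-occur unstuck stuck }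
    where
    occ = all-occur unstuck stuck
    index : Fin K → Fin (suc T)
    index c = fromℕ< (s≤s (proj₁ (proj₂ (occ (finToVec c)))))
    index-injective : Injective _≡_ _≡_ index
    index-injective {c} {c′} e = finToVec-injective (begin
      finToVec c                    ≡⟨ proj₂ (proj₂ (occ (finToVec c))) ⟨
      w (proj₁ (occ (finToVec c)))  ≡⟨ cong w indices≡ ⟩
      w (proj₁ (occ (finToVec c′))) ≡⟨ proj₂ (proj₂ (occ (finToVec c′))) ⟩
      finToVec c′                   ∎)
      where
      open ≡-Reasoning
      indices≡ : proj₁ (occ (finToVec c)) ≡ proj₁ (occ (finToVec c′))
      indices≡ = trans (sym (FinP.toℕ-fromℕ< _)) (trans (cong toℕ e) (FinP.toℕ-fromℕ< _))
    K≤1+T : K ℕ.≤ suc T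
    K≤1+T = FinP.injective⇒≤ index-injective

module Cycle (m j : ℕ) where

  open Game m j
  open PreferMax m j
  open Enumeration enumeration public

  index : Word → ℕ
  index v = proj₁ (occurs v)

  index≤T : ∀ v → index v ℕ.≤ T
  index≤T v = proj₁ (proj₂ (occurs v))

  w-index : ∀ v → w (index v) ≡ v
  w-index v = proj₂ (proj₂ (occurs v))

  index-unique : ∀ {v i} → i ℕ.≤ T → w i ≡ v → index v ≡ i
  index-unique i≤T refl = w-injective unstuck (index≤T _) i≤T (w-index _)

  w-injective≤T : ∀ {i i′} → i ℕ.≤ T → i′ ℕ.≤ T → w i ≡ w i′ → i ≡ i′
  w-injective≤T = w-injective unstuck

  zeros≡0s∷ʳ0 : zeros ≡ 0s ∷ʳ zero
  zeros≡0s∷ʳ0 = sym (replicate-∷ʳ m)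

  -- 0ⁿ can only be followed by words that already occurred, so it comes last
  w-T : w T ≡ zeros
  w-T with ℕP.m≤n⇒m<n∨m≡n (index≤T zeros)
  ... | inj₂ index≡T = trans (cong w (sym index≡T)) (w-index zeros)
  ... | inj₁ index<T = ⊥-elim (unstuck (index zeros) index<T zeros-stuck)
    where
    zeros-stuck : Stuck (index zeros)
    zeros-stuck τ = subst (λ z → Occurs≤ (index zeros) (z ∷ʳ τ)) (sym (cong tail (w-index zeros)))
      (x∷ʳ0-occurs⇒x∷ʳc-occurs (index zeros , ℕP.≤-refl , trans (w-index zeros) zeros≡0s∷ʳ0) τ)

  index<T : ∀ {v} → v ≢ zeros → index v ℕ.< T
  index<T {v} v≢zeros with ℕP.m≤n⇒m<n∨m≡n (index≤T v)
  ... | inj₁ index<T = index<T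
  ... | inj₂ index≡T = ⊥-elim (v≢zeros (trans (sym (w-index v)) (trans (cong w index≡T) w-T)))

  next : Vec Letter m → Letter → Letter
  next x c = last (w (suc (index (c ∷ x))))

  w-suc-index : ∀ {x c} → c ∷ x ≢ zeros → w (suc (index (c ∷ x))) ≡ x ∷ʳ next x c
  w-suc-index {x} {c} c∷x≢zeros =
    trans (w-suc-shape unstuck (index<T c∷x≢zeros)) (cong (_∷ʳ next x c) (cong tail (w-index (c ∷ x))))

  next-injective : ∀ {x a b} → a ∷ x ≢ zeros → b ∷ x ≢ zeros → next x a ≡ next x b → a ≡ b
  next-injective {x} {a} {b} a∷x≢zeros b∷x≢zeros e =
    VecP.∷-injectiveˡ (trans (sym (w-index _)) (trans (cong w indices≡) (w-index _)))
    where
    indices≡ : index (a ∷ x) ≡ index (b ∷ x)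
    indices≡ = ℕP.suc-injective (w-injective≤T (index<T a∷x≢zeros) (index<T b∷x≢zeros)
                 (trans (w-suc-index a∷x≢zeros) (trans (cong (x ∷ʳ_) e) (sym (w-suc-index b∷x≢zeros)))))

  index<⇒next> : ∀ {x a b} → a ∷ x ≢ zeros → b ∷ x ≢ zeros →
                 index (a ∷ x) ℕ.< index (b ∷ x) → next x b Fin.< next x a
  index<⇒next> {x} {a} {b} a∷x≢zeros b∷x≢zeros a<b with FinP.<-cmp (next x b) (next x a)
  ... | tri< nb<na _ _ = nb<na
  ... | tri≈ _ nb≡na _ =
    ⊥-elim (ℕP.<-irrefl (cong (λ c → index (c ∷ x)) (sym (next-injective b∷x≢zeros a∷x≢zeros nb≡na))) a<b)
  ... | tri> _ _ na<nb with larger-last-occurs-earlier (suc (index (a ∷ x))) (next x b) na<nb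
  ...   | i , i<1+a , w≡ = ⊥-elim (ℕP.<-asym a<b (ℕP.≤-pred (subst (ℕ._< suc (index (a ∷ x))) i≡1+b i<1+a)))
    where
    i≡1+b : i ≡ suc (index (b ∷ x))
    i≡1+b = w-injective≤T (ℕP.≤-trans (ℕP.<⇒≤ i<1+a) (index<T a∷x≢zeros)) (index<T b∷x≢zeros)
              (trans w≡ (trans (cong (λ z → init z ∷ʳ next x b) (w-suc-index a∷x≢zeros))
                (trans (cong (_∷ʳ next x b) (VecP.init-∷ʳ _ x)) (sym (w-suc-index b∷x≢zeros)))))

  next<⇒index< : ∀ {x a b} → a ∷ x ≢ zeros → b ∷ x ≢ zeros →
                 next x b Fin.< next x a → index (a ∷ x) ℕ.< index (b ∷ x)
  next<⇒index< {x} {a} {b} a∷x≢zeros b∷x≢zeros nb<na with ℕP.<-cmp (index (a ∷ x)) (index (b ∷ x))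
  ... | tri< a<b _ _ = a<b
  ... | tri≈ _ a≡b _ = ⊥-elim (ℕP.<-irrefl (cong (toℕ ∘ next x) (sym letters≡)) nb<na)
    where
    letters≡ : a ≡ b
    letters≡ = VecP.∷-injectiveˡ (trans (sym (w-index _)) (trans (cong w a≡b) (w-index _)))
  ... | tri> _ _ b<a = ⊥-elim (ℕP.<-asym nb<na (index<⇒next> b∷x≢zeros a∷x≢zeros b<a))

  nonzero∷x≢zeros : ∀ {x : Vec Letter m} {a : Letter} → 0 ℕ.< toℕ a → a ∷ x ≢ zeros
  nonzero∷x≢zeros 0<a refl = ℕP.<-irrefl refl 0<a

  next-increasing : ∀ {x a b} → 0 ℕ.< toℕ a → a Fin.< b → next x a Fin.< next x b
  next-increasing {x} {a} {b} 0<a a<b =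
    index<⇒next> (nonzero∷x≢zeros (ℕP.<-trans 0<a a<b)) (nonzero∷x≢zeros 0<a) b<a
    where
    b<a : index (b ∷ x) ℕ.< index (a ∷ x)
    b<a with raised-occurs-earlier (index (a ∷ x)) (b ∷ x)
               (subst (λ z → Raise z (b ∷ x)) (sym (w-index (a ∷ x))) (Raise-head x 0<a a<b))
    ... | i , i<a , w≡ = subst (ℕ._< index (a ∷ x)) (sym (index-unique (ℕP.≤-trans (ℕP.<⇒≤ i<a) (index≤T _)) w≡)) i<a

  next-0s≢top : ∀ {a} → 0 ℕ.< toℕ a → next 0s a ≢ top
  next-0s≢top 0<a next≡top = ℕP.0≢1+n (sym (w-injective≤T (index<T (nonzero∷x≢zeros 0<a)) z≤n
    (trans (w-suc-index (nonzero∷x≢zeros 0<a)) (cong (0s ∷ʳ_) next≡top))))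

  any-at-index : ∀ (f : ℕ → Bool) v → any (λ i → ⌊ w i ≟w v ⌋ Bool.∧ f i) (upTo K) ≡ f (index v)
  any-at-index f v = trans (any-select _ (∈P.∈-upTo⁺ index<K) only-index)
                           (cong (Bool._∧ f (index v)) (Equivalence.to BoolP.T-≡ (fromWitness {a? = w (index v) ≟w v} (w-index v))))
    where
    index<K : index v ℕ.< K
    index<K = subst (index v ℕ.<_) 1+T≡K (s≤s (index≤T v))
    only-index : ∀ {i} → i ∈ upTo K → Bool.T (⌊ w i ≟w v ⌋ Bool.∧ f i) → i ≡ index v
    only-index {i} i∈ wi≡v∧fi =
      sym (index-unique i≤T (toWitness {a? = w i ≟w v} (proj₁ (Equivalence.to (BoolP.T-∧ {⌊ w i ≟w v ⌋}) wi≡v∧fi))))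
      where
      i≤T : i ℕ.≤ T
      i≤T = ℕP.≤-pred (subst (i ℕ.<_) (sym 1+T≡K) (∈P.∈-upTo⁻ i∈))

module Moves (m j : ℕ) where

  open Game m j

  data MoveView (A B : Word → Bool) (s : Word) : Word → Set where
    bob-raises : ∀ {b} → B s ≡ true → inc (last s) ≡ just b → MoveView A B s (b ∷ init s)
    bob-at-top : B s ≡ true → inc (last s) ≡ nothing → MoveView A B s (last s ∷ init s)
    alice-resets : B s ≡ false → A s ≡ true → MoveView A B s (zero ∷ init s)
    rotate : B s ≡ false → A s ≡ false → MoveView A B s (last s ∷ init s)

  move-view : ∀ A B s → MoveView A B s (move A B s)
  move-view A B s with B s in B≡ | A s in A≡ | inc (last s) in inc≡
  ... | true | _ | just b = bob-raises B≡ inc≡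
  ... | true | _ | nothing = bob-at-top B≡ inc≡
  ... | false | true | _ = alice-resets B≡ A≡
  ... | false | false | _ = rotate B≡ A≡

  move-cong : ∀ {A A′ B B′} s → A s ≡ A′ s → B s ≡ B′ s → move A B s ≡ move A′ B′ s
  move-cong {A} {A′} {B} {B′} s A≡ B≡ with B s | B′ s | A s | A′ s | inc (last s) | A≡ | B≡
  ... | _ | _ | _ | _ | _ | refl | refl = refl

  move-reset : ∀ {A B s} → B s ≡ false → A s ≡ true → move A B s ≡ zero ∷ init s
  move-reset {A} {B} {s} B≡ A≡ with B s | A s | inc (last s) | B≡ | A≡
  ... | _ | _ | _ | refl | refl = refl

  move-rotate : ∀ {A B s} → B s ≡ false → A s ≡ false → move A B s ≡ last s ∷ init s
  move-rotate {A} {B} {s} B≡ A≡ with B s | A s | inc (last s) | B≡ | A≡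
  ... | _ | _ | _ | refl | refl = refl

module Strategies (m j : ℕ) where

  open Game m j
  open PreferMax m j using (Letter; 0s; top-maximal; w-pred-shape)
  open Cycle m j
  open Moves m j

  private
    true≢false : true ≢ false
    true≢false ()

  Astar-at : ∀ v → Astar v ≡ AstarAt (index v)
  Astar-at = any-at-index AstarAt

  Bstar-at : ∀ v → Bstar v ≡ BstarAt (index v)
  Bstar-at = any-at-index BstarAt

  -- w i = x_ i ∷ʳ σ_ i, and the preceding word is ρ_ i ∷ x_ i (prev 0 = T)
  x_ : ℕ → Vec Letter m
  x_ i = init (w i)

  σ_ : ℕ → Letter
  σ_ i = last (w i)

  ρ_ : ℕ → Letter
  ρ_ i = Vec.head (w (prev i))

  w-prev-zero : w (prev 0) ≡ zeros
  w-prev-zero = trans (cong w (cong (_∸ 1) (sym 1+T≡K))) w-T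

  w-prev : ∀ i → i ℕ.≤ T → w (prev i) ≡ ρ_ i ∷ x_ i
  w-prev zero _ = trans (head∷tail (w (prev 0)))
    (cong (ρ_ 0 ∷_) (trans (cong tail w-prev-zero) (sym (VecP.init-∷ʳ top (replicate m zero)))))
  w-prev (suc p) 1+p≤T = w-pred-shape unstuck 1+p≤T (init∷ʳlast (w (suc p)))

  BstarAt-true : ∀ i → i ℕ.≤ T → BstarAt i ≡ true → inc (σ_ i) ≡ just (ρ_ i)
  BstarAt-true i i≤T B≡ with inc (σ_ i) | B≡
  ... | just b | B≡′ with w (prev i) ≟w (b ∷ x_ i)
  ...   | yes w≡ = cong just (sym (VecP.∷-injectiveˡ (trans (sym (w-prev i i≤T)) w≡)))

  BstarAt-false : ∀ i → i ℕ.≤ T → BstarAt i ≡ false → inc (σ_ i) ≢ just (ρ_ i)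
  BstarAt-false i i≤T B≡ with inc (σ_ i) | B≡
  ... | just b | B≡′ with w (prev i) ≟w (b ∷ x_ i)
  ...   | no w≢ = λ { refl → w≢ (w-prev i i≤T) }

  AstarAt-true : ∀ i → i ℕ.≤ T → AstarAt i ≡ true → σ_ i ≢ zero × (ρ_ i ≡ zero ⊎ BstarAt i ≡ true)
  AstarAt-true i i≤T A≡ with σ_ i Fin.≟ zero | w (prev i) ≟w (zero ∷ x_ i) | BstarAt i
  ... | no σ≢0 | yes w≡ | _ = σ≢0 , inj₁ (VecP.∷-injectiveˡ (trans (sym (w-prev i i≤T)) w≡))
  ... | no σ≢0 | no _ | true = σ≢0 , inj₂ refl

  AstarAt-false : ∀ i → i ℕ.≤ T → AstarAt i ≡ false → σ_ i ≡ zero ⊎ (ρ_ i ≢ zero × BstarAt i ≡ false)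
  AstarAt-false i i≤T A≡ with σ_ i Fin.≟ zero | w (prev i) ≟w (zero ∷ x_ i) | BstarAt i
  ... | yes σ≡0 | _ | _ = inj₁ σ≡0
  ... | no _ | no w≢ | false = inj₂ ((λ ρ≡0 → w≢ (trans (w-prev i i≤T) (cong (_∷ x_ i) ρ≡0))) , refl)

  AstarAt-zero : AstarAt 0 ≡ true
  AstarAt-zero with σ_ 0 Fin.≟ zero | w (prev 0) ≟w (zero ∷ x_ 0)
  ... | yes σ≡0 | _ with () ← trans (sym (VecP.last-∷ʳ top (replicate m zero))) σ≡0
  ... | no _ | yes _ = refl
  ... | no _ | no w≢ = ⊥-elim (w≢ (trans (w-prev 0 z≤n) (cong (_∷ x_ 0) (cong Vec.head w-prev-zero))))

  AstarAt-last-zero : ∀ i → σ_ i ≡ zero → AstarAt i ≡ false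
  AstarAt-last-zero i σ≡0 with σ_ i Fin.≟ zero
  ... | yes _ = refl
  ... | no σ≢0 = ⊥-elim (σ≢0 σ≡0)

  BstarAt-last-top : ∀ i → σ_ i ≡ top → BstarAt i ≡ false
  BstarAt-last-top i σ≡top with inc (σ_ i) in inc≡
  ... | nothing = refl
  ... | just _ with () ← trans (sym (trans (cong inc σ≡top) (inc-fromℕ (suc j)))) inc≡

  Astar-isAliceStrategy : IsAliceStrategy Astar
  Astar-isAliceStrategy x = trans (Astar-at (x ∷ʳ zero))
    (AstarAt-last-zero _ (trans (cong last (w-index _)) (VecP.last-∷ʳ zero x)))

  Bstar-isBobStrategy : IsBobStrategy Bstar
  Bstar-isBobStrategy x = trans (Bstar-at (x ∷ʳ top))
    (BstarAt-last-top _ (trans (cong last (w-index _)) (VecP.last-∷ʳ top x)))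

  nonzero⇒0< : ∀ {c : Letter} → c ≢ zero → 0 ℕ.< toℕ c
  nonzero⇒0< {zero} c≢0 = ⊥-elim (c≢0 refl)
  nonzero⇒0< {suc c} _ = s≤s z≤n

  module AtSuc (p : ℕ) (1+p≤T : suc p ℕ.≤ T) where

    x = x_ (suc p)
    σ = σ_ (suc p)
    ρ = ρ_ (suc p)

    open IncreasingOnNonzero (next x) next-increasing public

    w-p : w p ≡ ρ ∷ x
    w-p = w-prev (suc p) 1+p≤T

    ρ∷x≢zeros : ρ ∷ x ≢ zeros
    ρ∷x≢zeros e = ℕP.<-irrefl (w-injective≤T (ℕP.<⇒≤ 1+p≤T) ℕP.≤-refl (trans w-p (trans e (sym w-T)))) 1+p≤T

    index-ρ∷x : index (ρ ∷ x) ≡ p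
    index-ρ∷x = index-unique (ℕP.<⇒≤ 1+p≤T) w-p

    index-ρ∷x<1+p : index (ρ ∷ x) ℕ.< suc p
    index-ρ∷x<1+p = s≤s (ℕP.≤-reflexive index-ρ∷x)

    next-ρ≡σ : next x ρ ≡ σ
    next-ρ≡σ = cong (λ z → last (w (suc z))) index-ρ∷x

    x≢0s⇒c∷x≢zeros : x ≢ 0s → ∀ {c} → c ∷ x ≢ zeros
    x≢0s⇒c∷x≢zeros x≢0s e = x≢0s (VecP.∷-injectiveʳ e)

    x≢0s⇒next-injective : x ≢ 0s → Injective _≡_ _≡_ (next x)
    x≢0s⇒next-injective x≢0s = next-injective (x≢0s⇒c∷x≢zeros x≢0s) (x≢0s⇒c∷x≢zeros x≢0s)

    σ≤next⇒index<p : ∀ {c} → c ∷ x ≢ zeros → c ≢ ρ → toℕ σ ℕ.≤ toℕ (next x c) → index (c ∷ x) ℕ.< p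
    σ≤next⇒index<p {c} c∷x≢zeros c≢ρ σ≤next = subst (index (c ∷ x) ℕ.<_) index-ρ∷x
      (next<⇒index< c∷x≢zeros ρ∷x≢zeros next-ρ<next-c)
      where
      next-ρ<next-c : next x ρ Fin.< next x c
      next-ρ<next-c with ℕP.m≤n⇒m<n∨m≡n σ≤next
      ... | inj₁ σ<next = subst (λ z → toℕ z ℕ.< toℕ (next x c)) (sym next-ρ≡σ) σ<next
      ... | inj₂ σ≡next = ⊥-elim (c≢ρ (next-injective c∷x≢zeros ρ∷x≢zeros
                             (FinP.toℕ-injective (trans (sym σ≡next) (cong toℕ (sym next-ρ≡σ))))))

    next<σ⇒p<index : ∀ {c} → c ∷ x ≢ zeros → toℕ (next x c) ℕ.< toℕ σ → p ℕ.< index (c ∷ x)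
    next<σ⇒p<index {c} c∷x≢zeros next<σ = subst (ℕ._< index (c ∷ x)) index-ρ∷x
      (next<⇒index< ρ∷x≢zeros c∷x≢zeros (subst (λ z → toℕ (next x c) ℕ.< toℕ z) (sym next-ρ≡σ) next<σ))

    -- next x ρ = σ forces ρ ∈ {σ, σ+1}
    ρ≡σ : ρ ≢ zero → inc σ ≢ just ρ → ρ ≡ σ
    ρ≡σ ρ≢0 inc≢ with ℕP.m≤n⇒m<n∨m≡n (subst (λ z → toℕ ρ ℕ.≤ suc (toℕ z)) next-ρ≡σ (a≤1+g[a] ρ (nonzero⇒0< ρ≢0)))
    ... | inj₂ ρ≡1+σ = ⊥-elim (inc≢ (inc-suc ρ≡1+σ))
    ... | inj₁ ρ<1+σ = FinP.toℕ-injective (ℕP.≤-antisym (ℕP.≤-pred ρ<1+σ)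
                         (subst (λ z → toℕ z ℕ.≤ toℕ ρ) next-ρ≡σ (g[a]≤a ρ (nonzero⇒0< ρ≢0))))

    index-w-1+p : index (w (suc p)) ≡ suc p
    index-w-1+p = index-unique 1+p≤T refl

    AstarAt≡ : ∀ {b} → Astar (w (suc p)) ≡ b → AstarAt (suc p) ≡ b
    AstarAt≡ A≡ = trans (sym (cong AstarAt index-w-1+p)) (trans (sym (Astar-at _)) A≡)

    BstarAt≡ : ∀ {b} → Bstar (w (suc p)) ≡ b → BstarAt (suc p) ≡ b
    BstarAt≡ B≡ = trans (sym (cong BstarAt index-w-1+p)) (trans (sym (Bstar-at _)) B≡)

    raised-index< : ∀ {b} → inc σ ≡ just b → index (b ∷ x) ℕ.< suc p
    raised-index< {b} inc≡ with b FinP.≟ ρ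
    ... | yes refl = index-ρ∷x<1+p
    ... | no b≢ρ = ℕP.m<n⇒m<1+n (σ≤next⇒index<p (nonzero∷x≢zeros 0<b) b≢ρ σ≤next)
      where
      0<b : 0 ℕ.< toℕ b
      0<b = subst (0 ℕ.<_) (sym (inc≡just⇒ {σ = σ} inc≡)) (s≤s z≤n)
      σ≤next : toℕ σ ℕ.≤ toℕ (next x b)
      σ≤next = ℕP.≤-pred (subst (ℕ._≤ suc (toℕ (next x b))) (inc≡just⇒ {σ = σ} inc≡) (a≤1+g[a] b 0<b))

    reset-descends : σ ≢ zero × (ρ ≡ zero ⊎ BstarAt (suc p) ≡ true) → zero ∷ x ≡ zeros ⊎ index (zero ∷ x) ℕ.< suc p
    reset-descends (σ≢0 , ρ≡0⊎B) with VecP.≡-dec FinP._≟_ x 0s | ρ≡0⊎B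
    ... | yes x≡0s | _ = inj₁ (cong (zero ∷_) x≡0s)
    ... | no x≢0s | inj₁ ρ≡0 = inj₂ (subst (λ z → index (z ∷ x) ℕ.< suc p) ρ≡0 index-ρ∷x<1+p)
    ... | no x≢0s | inj₂ B≡ = inj₂ (ℕP.m<n⇒m<1+n
      (σ≤next⇒index<p (x≢0s⇒c∷x≢zeros x≢0s) (λ 0≡ρ → ℕP.0≢1+n (trans (cong toℕ 0≡ρ) ρ≡1+σ)) (ℕP.<⇒≤ σ<next0)))
      where
      ρ≡1+σ : toℕ ρ ≡ suc (toℕ σ)
      ρ≡1+σ = inc≡just⇒ {σ = σ} (BstarAt-true (suc p) 1+p≤T B≡)
      σ<next0 : toℕ σ ℕ.< toℕ (next x zero)
      σ<next0 = g[1+σ]≡σ⇒σ<g[0] (x≢0s⇒next-injective x≢0s) σ ρ ρ≡1+σ next-ρ≡σ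

    rotate-descends : σ ≡ zero ⊎ (ρ ≢ zero × BstarAt (suc p) ≡ false) → σ ∷ x ≡ zeros ⊎ index (σ ∷ x) ℕ.< suc p
    rotate-descends (inj₂ (ρ≢0 , B≡)) =
      inj₂ (subst (λ z → index (z ∷ x) ℕ.< suc p) (ρ≡σ ρ≢0 (BstarAt-false (suc p) 1+p≤T B≡)) index-ρ∷x<1+p)
    rotate-descends (inj₁ σ≡0) with VecP.≡-dec FinP._≟_ x 0s | ρ FinP.≟ zero
    ... | yes x≡0s | _ = inj₁ (cong₂ _∷_ σ≡0 x≡0s)
    ... | no _ | yes ρ≡0 = inj₂ (subst (λ z → index (z ∷ x) ℕ.< suc p) (trans ρ≡0 (sym σ≡0)) index-ρ∷x<1+p)
    ... | no x≢0s | no ρ≢0 = inj₂ (subst (λ z → index (z ∷ x) ℕ.< suc p) (sym σ≡0) (ℕP.m<n⇒m<1+n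
      (σ≤next⇒index<p (x≢0s⇒c∷x≢zeros x≢0s) (ρ≢0 ∘ sym) (subst (λ z → toℕ z ℕ.≤ toℕ (next x zero)) (sym σ≡0) z≤n))))

    Astar-descends : ∀ B → IsBobStrategy B →
                     move Astar B (w (suc p)) ≡ zeros ⊎ index (move Astar B (w (suc p))) ℕ.< suc p
    Astar-descends B bob with move Astar B (w (suc p)) | move-view Astar B (w (suc p))
    ... | _ | bob-raises B≡ inc≡ = inj₂ (raised-index< inc≡)
    ... | _ | bob-at-top B≡ inc≡ = ⊥-elim (true≢false (trans (sym B≡) (trans (cong B w≡x∷ʳtop) (bob x))))
      where
      w≡x∷ʳtop : w (suc p) ≡ x ∷ʳ top
      w≡x∷ʳtop = trans (init∷ʳlast (w (suc p))) (cong (x ∷ʳ_) (inc≡nothing⇒ inc≡))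
    ... | _ | alice-resets _ A≡ = reset-descends (AstarAt-true (suc p) 1+p≤T (AstarAt≡ A≡))
    ... | _ | rotate _ A≡ = rotate-descends (AstarAt-false (suc p) 1+p≤T (AstarAt≡ A≡))

    Astar-Bstar-backtracks : move Astar Bstar (w (suc p)) ≡ w p
    Astar-Bstar-backtracks = trans backtrack (sym w-p)
      where
      backtrack : move Astar Bstar (w (suc p)) ≡ ρ ∷ x
      backtrack with move Astar Bstar (w (suc p)) | move-view Astar Bstar (w (suc p))
      ... | _ | bob-raises B≡ inc≡ with refl ← trans (sym inc≡) (BstarAt-true (suc p) 1+p≤T (BstarAt≡ B≡)) = refl
      ... | _ | bob-at-top B≡ inc≡ with () ← trans (sym inc≡) (BstarAt-true (suc p) 1+p≤T (BstarAt≡ B≡))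
      ... | _ | alice-resets B≡ A≡ with AstarAt-true (suc p) 1+p≤T (AstarAt≡ A≡)
      ...   | _ , inj₁ ρ≡0 = cong (_∷ x) (sym ρ≡0)
      ...   | _ , inj₂ B≡′ = ⊥-elim (true≢false (trans (sym B≡′) (BstarAt≡ B≡)))
      backtrack | _ | rotate B≡ A≡ with ρ FinP.≟ zero | AstarAt-false (suc p) 1+p≤T (AstarAt≡ A≡)
      ... | no ρ≢0 | _ = cong (_∷ x) (sym (ρ≡σ ρ≢0 (BstarAt-false (suc p) 1+p≤T (BstarAt≡ B≡))))
      ... | yes ρ≡0 | inj₁ σ≡0 = cong (_∷ x) (trans σ≡0 (sym ρ≡0))
      ... | yes ρ≡0 | inj₂ (ρ≢0 , _) = ⊥-elim (ρ≢0 ρ≡0)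

    rotate-deviates : σ ≢ zero × (ρ ≡ zero ⊎ BstarAt (suc p) ≡ true) →
                      σ ∷ x ≢ zeros × suc p ℕ.≤ index (σ ∷ x)
    rotate-deviates (σ≢0 , ρ≡0⊎B) = σ∷x≢zeros , next<σ⇒p<index σ∷x≢zeros (next<σ ρ≡0⊎B)
      where
      0<σ = nonzero⇒0< σ≢0
      σ∷x≢zeros = nonzero∷x≢zeros 0<σ
      next<σ : ρ ≡ zero ⊎ BstarAt (suc p) ≡ true → toℕ (next x σ) ℕ.< toℕ σ
      next<σ (inj₁ ρ≡0) = ℕP.≤∧≢⇒< (g[a]≤a σ 0<σ) λ next≡σ →
        σ≢0 (trans (next-injective σ∷x≢zeros ρ∷x≢zeros (trans (FinP.toℕ-injective next≡σ) (sym next-ρ≡σ))) ρ≡0)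
      next<σ (inj₂ B≡) = subst (λ z → toℕ (next x σ) ℕ.< toℕ z) next-ρ≡σ (next-increasing 0<σ σ<ρ)
        where
        σ<ρ : σ Fin.< ρ
        σ<ρ = ℕP.≤-reflexive (sym (inc≡just⇒ {σ = σ} (BstarAt-true (suc p) 1+p≤T B≡)))

    reset-deviates : σ ≢ zero → σ ≡ zero ⊎ (ρ ≢ zero × BstarAt (suc p) ≡ false) →
                     zero ∷ x ≢ zeros × suc p ℕ.≤ index (zero ∷ x)
    reset-deviates σ≢0 (inj₁ σ≡0) = ⊥-elim (σ≢0 σ≡0)
    reset-deviates σ≢0 (inj₂ (ρ≢0 , B≡)) = deviates (VecP.≡-dec FinP._≟_ x 0s)
      where
      0<σ = nonzero⇒0< σ≢0
      next-σ≡σ : next x σ ≡ σ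
      next-σ≡σ = trans (cong (next x) (sym (ρ≡σ ρ≢0 (BstarAt-false (suc p) 1+p≤T B≡)))) next-ρ≡σ
      deviates : Dec (x ≡ 0s) → zero ∷ x ≢ zeros × suc p ℕ.≤ index (zero ∷ x)
      deviates (yes x≡0s) = ⊥-elim (ℕP.<-irrefl (cong toℕ (subst (λ z → next z σ ≡ σ) x≡0s next-σ≡σ))
        (IncreasingOnNonzero.g≢top⇒g[a]<a (next 0s) next-increasing (λ _ → next-0s≢top) σ 0<σ))
      deviates (no x≢0s) = x≢0s⇒c∷x≢zeros x≢0s , next<σ⇒p<index (x≢0s⇒c∷x≢zeros x≢0s)
        (g[σ]≡σ⇒g[0]<σ (x≢0s⇒next-injective x≢0s) σ 0<σ next-σ≡σ)

    deviation : ∀ {A B} → IsAliceStrategy A → B (w (suc p)) ≡ false → A (w (suc p)) ≢ Astar (w (suc p)) →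
                move A B (w (suc p)) ≢ zeros × suc p ℕ.≤ index (move A B (w (suc p)))
    deviation {A} {B} alice B≡ A≢ with move A B (w (suc p)) | move-view A B (w (suc p))
    ... | _ | bob-raises B≡′ _ = ⊥-elim (true≢false (trans (sym B≡′) B≡))
    ... | _ | bob-at-top B≡′ _ = ⊥-elim (true≢false (trans (sym B≡′) B≡))
    ... | _ | alice-resets _ A≡ = reset-deviates σ≢0 (AstarAt-false (suc p) 1+p≤T (AstarAt≡ Astar≡false))
      where
      Astar≡false : Astar (w (suc p)) ≡ false
      Astar≡false = trans (BoolP.¬-not (A≢ ∘ sym)) (cong Bool.not A≡)
      σ≢0 : σ ≢ zero
      σ≢0 σ≡0 = true≢false (trans (sym A≡) (trans (cong A (trans (init∷ʳlast (w (suc p))) (cong (x ∷ʳ_) σ≡0))) (alice x)))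
    ... | _ | rotate _ A≡ = rotate-deviates (AstarAt-true (suc p) 1+p≤T (AstarAt≡ Astar≡true))
      where
      Astar≡true : Astar (w (suc p)) ≡ true
      Astar≡true = trans (BoolP.¬-not (A≢ ∘ sym)) (cong Bool.not A≡)

  Astar-w₀ : Astar (w 0) ≡ true
  Astar-w₀ = trans (Astar-at (w 0)) (trans (cong AstarAt (index-unique z≤n refl)) AstarAt-zero)

  Astar-descends : ∀ B → IsBobStrategy B → ∀ v → move Astar B v ≡ zeros ⊎ index (move Astar B v) ℕ.< index v
  Astar-descends B bob v with index v | index≤T v | w-index v
  ... | zero | _ | refl = inj₁ (trans (move-reset {Astar} {B} (bob 0s) Astar-w₀) (cong (zero ∷_) (VecP.init-∷ʳ top 0s)))
  ... | suc p | 1+p≤T | refl = AtSuc.Astar-descends p 1+p≤T B bob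

  deviation : ∀ {A B} i → i ℕ.≤ T → IsAliceStrategy A → B (w i) ≡ false → A (w i) ≢ Astar (w i) →
              move A B (w i) ≢ zeros × i ℕ.≤ index (move A B (w i))
  deviation {A} {B} zero _ _ B≡ A≢ = o≢zeros , z≤n
    where
    A≡false : A (w 0) ≡ false
    A≡false = trans (BoolP.¬-not A≢) (cong Bool.not Astar-w₀)
    o≢zeros : move A B (w 0) ≢ zeros
    o≢zeros e with () ← trans (sym (VecP.last-∷ʳ top 0s)) (VecP.∷-injectiveˡ (trans (sym (move-rotate {A} {B} B≡ A≡false)) e))
  deviation {A} {B} (suc p) 1+p≤T alice B≡ A≢ = AtSuc.deviation p 1+p≤T {A} {B} alice B≡ A≢

  Astar-play-descends : ∀ B → IsBobStrategy B → ∀ s → (∀ s′ → 0 ℕ.< s′ → s′ ℕ.≤ s → play Astar B s′ ≢ zeros) →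
                        ∀ s₁ → s₁ ℕ.< s → index (play Astar B s) ℕ.< index (play Astar B s₁)
  Astar-play-descends B bob (suc s) nonzero s₁ s₁<1+s with Astar-descends B bob (play Astar B s)
  ... | inj₁ zeros-reached = ⊥-elim (nonzero (suc s) (s≤s z≤n) ℕP.≤-refl zeros-reached)
  ... | inj₂ descends with ℕP.m≤n⇒m<n∨m≡n (ℕP.≤-pred s₁<1+s)
  ...   | inj₂ refl = descends
  ...   | inj₁ s₁<s = ℕP.<-trans descends
          (Astar-play-descends B bob s (λ s′ 0<s′ s′≤s → nonzero s′ 0<s′ (ℕP.m≤n⇒m≤1+n s′≤s)) s₁ s₁<s)

  Astar-nonLosing : NonLosingAlice Astar
  Astar-nonLosing B bob (t , (_ , (s₁ , s₁<t , repeat) , first) , final≢zeros) =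
    ℕP.<-irrefl (cong index (sym repeat)) (Astar-play-descends B bob t nonzero s₁ s₁<t)
    where
    nonzero : ∀ s → 0 ℕ.< s → s ℕ.≤ t → play Astar B s ≢ zeros
    nonzero s 0<s s≤t s-zeros with ℕP.m≤n⇒m<n∨m≡n s≤t
    ... | inj₁ s<t = first s 0<s s<t (0 , 0<s , sym s-zeros)
    ... | inj₂ refl = final≢zeros s-zeros

  -- Bob plays B* except at the first deviation w i of A, and wins
  module Punish (A : Word → Bool) (alice : IsAliceStrategy A) (i : ℕ) (i≤T : i ℕ.≤ T)
                (agrees-above : ∀ i′ → i ℕ.< i′ → i′ ℕ.≤ T → A (w i′) ≡ Astar (w i′))
                (A≢ : A (w i) ≢ Astar (w i)) where

    B : Word → Bool
    B v = if ⌊ v ≟w w i ⌋ then false else Bstar v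

    B-at-i : B (w i) ≡ false
    B-at-i with w i ≟w w i
    ... | yes _ = refl
    ... | no w≢ = ⊥-elim (w≢ refl)

    B-elsewhere : ∀ {v} → v ≢ w i → B v ≡ Bstar v
    B-elsewhere {v} v≢ with v ≟w w i
    ... | yes v≡ = ⊥-elim (v≢ v≡)
    ... | no _ = refl

    B-isBobStrategy : IsBobStrategy B
    B-isBobStrategy x with (x ∷ʳ top) ≟w w i
    ... | yes _ = refl
    ... | no _ = Bstar-isBobStrategy x

    backtracking : ∀ s r → s + r ≡ T → i ℕ.≤ r → play A B s ≡ w r
    backtracking zero r r≡T _ = trans (sym w-T) (cong w (sym r≡T))
    backtracking (suc s) r 1+s+r≡T i≤r = begin
      move A B (play A B s)         ≡⟨ cong (move A B) (backtracking s (suc r) s+1+r≡T (ℕP.m≤n⇒m≤1+n i≤r)) ⟩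
      move A B (w (suc r))          ≡⟨ move-cong {A} {Astar} {B} {Bstar} (w (suc r)) (agrees-above (suc r) (s≤s i≤r) 1+r≤T) (B-elsewhere w≢) ⟩
      move Astar Bstar (w (suc r))  ≡⟨ AtSuc.Astar-Bstar-backtracks r 1+r≤T ⟩
      w r                           ∎
      where
      open ≡-Reasoning
      s+1+r≡T : s + suc r ≡ T
      s+1+r≡T = trans (ℕP.+-suc s r) 1+s+r≡T
      1+r≤T : suc r ℕ.≤ T
      1+r≤T = subst (suc r ℕ.≤_) s+1+r≡T (ℕP.m≤n+m (suc r) s)
      w≢ : w (suc r) ≢ w i
      w≢ e = ℕP.<-irrefl (sym (w-injective≤T 1+r≤T i≤T e)) (s≤s i≤r)

    s₀ : ℕ
    s₀ = T ∸ i

    play-backtracks : ∀ s → s ℕ.≤ s₀ → play A B s ≡ w (T ∸ s)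
    play-backtracks s s≤s₀ = backtracking s (T ∸ s) (ℕP.m+[n∸m]≡n s≤T)
      (ℕP.m+n≤o⇒m≤o∸n i (subst (ℕ._≤ T) (ℕP.+-comm s i) (ℕP.m≤o∸n⇒m+n≤o s i≤T s≤s₀)))
      where
      s≤T : s ℕ.≤ T
      s≤T = ℕP.≤-trans s≤s₀ (ℕP.m∸n≤m T i)

    o : Word
    o = move A B (w i)

    o≢zeros×i≤index : o ≢ zeros × i ℕ.≤ index o
    o≢zeros×i≤index = deviation {A} {B} i i≤T alice B-at-i A≢

    play-1+s₀ : play A B (suc s₀) ≡ o
    play-1+s₀ = cong (move A B) (trans (play-backtracks s₀ ℕP.≤-refl) (cong w (ℕP.m∸[m∸n]≡n i≤T)))

    bob-wins : BobWins A B
    bob-wins = suc s₀ , (s≤s z≤n , repeat , first) , λ e → proj₁ o≢zeros×i≤index (trans (sym play-1+s₀) e)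
      where
      T∸index≤s₀ : T ∸ index o ℕ.≤ s₀
      T∸index≤s₀ = ℕP.∸-monoʳ-≤ T (proj₂ o≢zeros×i≤index)
      repeat : Repeats A B (suc s₀)
      repeat = T ∸ index o , s≤s T∸index≤s₀ ,
        trans (play-backtracks _ T∸index≤s₀)
          (trans (cong w (ℕP.m∸[m∸n]≡n (index≤T o))) (trans (w-index o) (sym play-1+s₀)))
      first : ∀ t → 0 ℕ.< t → t ℕ.< suc s₀ → ¬ Repeats A B t
      first t _ t<1+s₀ (t′ , t′<t , repeat′) = ℕP.<-irrefl t′≡t t′<t
        where
        t≤s₀ = ℕP.≤-pred t<1+s₀
        t′≤s₀ = ℕP.≤-trans (ℕP.<⇒≤ t′<t) t≤s₀
        t′≡t : t′ ≡ t
        t′≡t = ℕP.∸-cancelˡ-≡ (ℕP.≤-trans t′≤s₀ (ℕP.m∸n≤m T i)) (ℕP.≤-trans t≤s₀ (ℕP.m∸n≤m T i))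
          (w-injective≤T (ℕP.m∸n≤m T t′) (ℕP.m∸n≤m T t)
            (trans (sym (play-backtracks t′ t′≤s₀)) (trans repeat′ (play-backtracks t t≤s₀))))

  nonLosing⇒agrees : ∀ A → IsAliceStrategy A → NonLosingAlice A →
                     ∀ d i → i ℕ.≤ T → T ∸ i ℕ.≤ d → A (w i) ≡ Astar (w i)
  nonLosing⇒agrees A alice nonLosing d i i≤T T∸i≤d with A (w i) BoolP.≟ Astar (w i)
  ... | yes A≡ = A≡
  ... | no A≢ = ⊥-elim (nonLosing B B-isBobStrategy bob-wins)
    where
    agrees-above : ∀ i′ → i ℕ.< i′ → i′ ℕ.≤ T → A (w i′) ≡ Astar (w i′)
    agrees-above i′ i<i′ i′≤T = below d (ℕP.<-≤-trans (ℕP.∸-monoʳ-< i<i′ i′≤T) T∸i≤d)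
      where
      below : ∀ d → T ∸ i′ ℕ.< d → A (w i′) ≡ Astar (w i′)
      below (suc d′) T∸i′<1+d′ = nonLosing⇒agrees A alice nonLosing d′ i′ i′≤T (ℕP.≤-pred T∸i′<1+d′)
    open Punish A alice i i≤T agrees-above A≢

  nonLosing⇒≡Astar : ∀ A → IsAliceStrategy A → NonLosingAlice A → ∀ v → A v ≡ Astar v
  nonLosing⇒≡Astar A alice nonLosing v = subst (λ z → A z ≡ Astar z) (w-index v)
    (nonLosing⇒agrees A alice nonLosing T (index v) (index≤T v) (ℕP.m∸n≤m T (index v)))

proposition19 : (m j : ℕ) → let open Game m j in
    (IsAliceStrategy Astar × NonLosingAlice Astar)
    × (∀ A → IsAliceStrategy A → NonLosingAlice A → ∀ v → A v ≡ Astar v)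
proposition19 m j = (Astar-isAliceStrategy , Astar-nonLosing) , nonLosing⇒≡Astar
  where open Strategies m j
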